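{- Let $m \geq 3$ and $S$ be a minimal zero-sum sequence with a support of size 3, $\{s_1, s_2, s_3 \} \subseteq \{ -m,\dots,m\}^2$, such that $\mathsf{D}^{(3)} (\{ -m,\dots,m\}^2) = |S|$. Let $A$ be the matrix, the $i$-th column of which is $s_i$ ($i=1,2,3$), then we have $A \in \mathcal{C}$ and $$ \mathsf{D}^{(3)} (\{ -m,\dots,m\}^2) = \sum_{i=1}^3 | \det A_i |. $$
   Context: A minimal zero-sum sequence is an unordered sequence summing to $0$ with no non-empty proper subsequence summing to $0$; $|S|$ is its length. $\mathsf{D}^{(3)}(X)$ is the maximal length of a minimal zero-sum sequence over $X$ with support (set of distinct elements) of size exactly $3$. $\{ -m,\dots,m\}$ denotes the set of integers $i$ with $-m\le i\le m$. For a $2\times 3$ matrix $A$ with coefficients in $\{ -m,\dots,m\}$, $A_i$ is the $2\times 2$ submatrix obtained by deleting the $i$-th column, and $\Delta(A)=\gcd(\det A_1,\det A_2,\det A_3)$. $\mathcal{C}$ is the set of $2\times 3$ matrices with coefficients in $\{ -m,\dots,m\}$ such that $\det A_1,\det A_2,\det A_3\neq 0$ and $\Delta(A)=1$. -}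

module Defs where

open import Data.Nat using (ℕ; _<_)
open import Data.Integer using (ℤ; +_; -_; _+_; _-_; _*_; _≤_; ∣_∣)
open import Data.Integer.GCD using (gcd)
open import Data.Fin using (Fin; zero; suc; punchIn)
open import Data.Product using (_×_; _,_; ∃)
open import Data.List using (List; []; foldr; length)
open import Data.List.Relation.Unary.All using (All)
open import Data.List.Membership.Propositional using (_∈_)
open import Data.List.Relation.Binary.Sublist.Propositional using (_⊆_)
open import Data.Sum using (_⊎_)
open import Relation.Binary.PropositionalEquality using (_≡_; _≢_)
open import Relation.Nullary using (¬_)

Point : Set
Point = ℤ × ℤ

_⊕_ : Point → Point → Point
(a , b) ⊕ (c , d) = (a + c , b + d)

origin : Point
origin = (+ 0 , + 0)

InRange : ℕ → ℤ → Set
InRange m x = (- (+ m) ≤ x) × (x ≤ + m)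

InBox : ℕ → Point → Set
InBox m (x , y) = InRange m x × InRange m y

-- A sequence (unordered; represented by a list, order irrelevant).
Seq : Set
Seq = List Point

σ : Seq → Point
σ = foldr _⊕_ origin

ZeroSum : Seq → Set
ZeroSum S = σ S ≡ origin

-- Subsequences (sub-multisets) are exactly the order-preserving sublists.
MinimalZeroSum : Seq → Set
MinimalZeroSum S =
  ZeroSum S ×
  (∀ (T : Seq) → T ⊆ S → T ≢ [] → length T < length S → ¬ ZeroSum T)

SupportIs : Seq → Point → Point → Point → Set
SupportIs S s₁ s₂ s₃ =
  (s₁ ≢ s₂) × (s₁ ≢ s₃) × (s₂ ≢ s₃) ×
  (s₁ ∈ S) × (s₂ ∈ S) × (s₃ ∈ S) ×
  All (λ x → (x ≡ s₁) ⊎ (x ≡ s₂) ⊎ (x ≡ s₃)) S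

SupportSize3 : Seq → Set
SupportSize3 S = ∃ λ s₁ → ∃ λ s₂ → ∃ λ s₃ → SupportIs S s₁ s₂ s₃

Admissible : ℕ → Seq → Set
Admissible m S = All (InBox m) S × MinimalZeroSum S × SupportSize3 S

-- |S| = D⁽³⁾({-m,…,m}²), i.e. S has maximal length among admissible sequences.
AttainsD3 : ℕ → Seq → Set
AttainsD3 m S = Admissible m S × (∀ T → Admissible m T → length T Data.Nat.≤ length S)

Mat23 : Set
Mat23 = Fin 2 → Fin 3 → ℤ

Mat22 : Set
Mat22 = Fin 2 → Fin 2 → ℤ

columns : Point → Point → Point → Mat23
columns (x , y) _ _ zero zero = x
columns (x , y) _ _ (suc zero) zero = y
columns _ (x , y) _ zero (suc zero) = x
columns _ (x , y) _ (suc zero) (suc zero) = y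
columns _ _ (x , y) zero (suc (suc zero)) = x
columns _ _ (x , y) (suc zero) (suc (suc zero)) = y

-- A_i: delete the i-th column.
minor : Mat23 → Fin 3 → Mat22
minor A i r c = A r (punchIn i c)

det2 : Mat22 → ℤ
det2 B = B zero zero * B (suc zero) (suc zero) - B zero (suc zero) * B (suc zero) zero

detA : Mat23 → Fin 3 → ℤ
detA A i = det2 (minor A i)

Δ : Mat23 → ℤ
Δ A = gcd (detA A zero) (gcd (detA A (suc zero)) (detA A (suc (suc zero))))

InC : ℕ → Mat23 → Set
InC m A =
  (∀ r c → InRange m (A r c)) ×
  (∀ i → detA A i ≢ + 0) ×
  (Δ A ≡ + 1)

module Submission where

-- A sequence supported on {s₁, s₂, s₃} is determined up to order by its multiplicities
-- a₁, a₂, a₃, and it is a minimal zero-sum sequence iff (a₁, a₂, a₃) is a minimal positive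
-- solution of a₁s₁ + a₂s₂ + a₃s₃ = 0. By Cramer's rule every solution is proportional to
-- (|det A₁|, |det A₂|, |det A₃|), and a minimal solution has coprime entries, so
-- aᵢ · Δ(A) = |det Aᵢ|. Explicit configurations give admissible sequences of length greater
-- than 3m², so a sequence of maximal length has ∑ aᵢ > 3m². This excludes Δ(A) = 0, where the
-- points are collinear and a one-dimensional argument bounds ∑ aᵢ by m² + 4m, and Δ(A) ≥ 2,
-- where 2 ∑ aᵢ ≤ ∑ |det Aᵢ| ≤ 6m². Hence Δ(A) = 1 and |S| = ∑ |det Aᵢ|.

open import Defs
open import Data.Empty using (⊥-elim)
open import Data.Fin using (zero; suc)
open import Data.Integer as ℤ using (ℤ; +_; -[1+_]; +[1+_]; +0; 0ℤ; -_; ∣_∣)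
import Data.Integer.Properties as ℤ
open import Data.Integer.Tactic.RingSolver renaming (solve-∀ to ℤ-solve-∀)
open import Data.List using (List; []; _∷_; _++_; length; replicate)
open import Data.List.Membership.Propositional using (_∈_)
open import Data.List.Relation.Binary.Sublist.Propositional using (_⊆_; []; _∷_; _∷ʳ_; ⊆-trans)
open import Data.List.Relation.Binary.Sublist.Propositional.Properties using (All-resp-⊆)
open import Data.List.Relation.Unary.All as All using (All; []; _∷_)
import Data.List.Relation.Unary.All.Properties as All
open import Data.List.Relation.Unary.Any using (here; there)
open import Data.Nat as ℕ using (ℕ; zero; suc; _+_; _*_; _≤_; _<_; _≥_; z≤n; s≤s; NonZero; _≤?_)
open import Data.Nat.Divisibility using (_∣_; ∣-trans)
open import Data.Nat.DivMod using (_/_; m*[n/m]≡n)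
open import Data.Nat.GCD
  using (gcd; gcd-zeroʳ; gcd[m,n]∣m; gcd[m,n]∣n; gcd[m,n]≡0⇒m≡0; c*gcd[m,n]≡gcd[cm,cn])
open import Data.Nat.Properties
open import Data.Nat.Tactic.RingSolver renaming (solve-∀ to ℕ-solve-∀)
open import Data.Product using (_×_; _,_; proj₁; proj₂; ∃-syntax)
open import Data.Product.Properties using (≡-dec)
open import Data.Sum using (_⊎_; inj₁; inj₂)
open import Relation.Binary.PropositionalEquality
  using (_≡_; _≢_; refl; sym; trans; cong; cong₂; subst; subst₂; ≢-sym; module ≡-Reasoning)
open import Relation.Nullary using (Dec; ¬_; yes; no)

gcd₃ : ℕ → ℕ → ℕ → ℕ
gcd₃ p₁ p₂ p₃ = gcd p₁ (gcd p₂ p₃)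

gcd₃∣₁ : ∀ p₁ p₂ p₃ → gcd₃ p₁ p₂ p₃ ∣ p₁
gcd₃∣₁ p₁ p₂ p₃ = gcd[m,n]∣m p₁ _

gcd₃∣₂ : ∀ p₁ p₂ p₃ → gcd₃ p₁ p₂ p₃ ∣ p₂
gcd₃∣₂ p₁ p₂ p₃ = ∣-trans (gcd[m,n]∣n p₁ _) (gcd[m,n]∣m p₂ p₃)

gcd₃∣₃ : ∀ p₁ p₂ p₃ → gcd₃ p₁ p₂ p₃ ∣ p₃
gcd₃∣₃ p₁ p₂ p₃ = ∣-trans (gcd[m,n]∣n p₁ _) (gcd[m,n]∣n p₂ p₃)

c*gcd₃≡gcd₃[c*] : ∀ c p₁ p₂ p₃ → c * gcd₃ p₁ p₂ p₃ ≡ gcd₃ (c * p₁) (c * p₂) (c * p₃)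
c*gcd₃≡gcd₃[c*] c p₁ p₂ p₃ =
  trans (c*gcd[m,n]≡gcd[cm,cn] c p₁ _) (cong (gcd (c * p₁)) (c*gcd[m,n]≡gcd[cm,cn] c p₂ p₃))

*-gcd₃-proportional : ∀ a p a₁ a₂ a₃ p₁ p₂ p₃ →
  a * p₁ ≡ a₁ * p → a * p₂ ≡ a₂ * p → a * p₃ ≡ a₃ * p →
  a * gcd₃ p₁ p₂ p₃ ≡ gcd₃ a₁ a₂ a₃ * p
*-gcd₃-proportional a p a₁ a₂ a₃ p₁ p₂ p₃ e₁ e₂ e₃ = begin
  a * gcd₃ p₁ p₂ p₃              ≡⟨ c*gcd₃≡gcd₃[c*] a p₁ p₂ p₃ ⟩
  gcd₃ (a * p₁) (a * p₂) (a * p₃) ≡⟨ cong₂ gcd (trans e₁ (*-comm a₁ p))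
                                      (cong₂ gcd (trans e₂ (*-comm a₂ p)) (trans e₃ (*-comm a₃ p))) ⟩
  gcd₃ (p * a₁) (p * a₂) (p * a₃) ≡⟨ sym (c*gcd₃≡gcd₃[c*] p a₁ a₂ a₃) ⟩
  p * gcd₃ a₁ a₂ a₃              ≡⟨ *-comm p _ ⟩
  gcd₃ a₁ a₂ a₃ * p              ∎
  where open ≡-Reasoning

-- Minimal solutions of a homogeneous linear equation in three unknowns

+-swap₁₂ : ∀ m n o → m + n + o ≡ n + m + o
+-swap₁₂ m n o = cong (_+ o) (+-comm m n)

+-swap₂₃ : ∀ m n o → m + n + o ≡ m + o + n
+-swap₂₃ = ℕ-solve-∀

record MinimalSolution (Z : ℕ → ℕ → ℕ → Set) (a₁ a₂ a₃ : ℕ) : Set where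
  field
    positive₁ : 1 ≤ a₁
    positive₂ : 1 ≤ a₂
    positive₃ : 1 ≤ a₃
    solution : Z a₁ a₂ a₃
    minimal : ∀ {b₁ b₂ b₃} → b₁ ≤ a₁ → b₂ ≤ a₂ → b₃ ≤ a₃ → 1 ≤ b₁ + b₂ + b₃ →
      Z b₁ b₂ b₃ → a₁ + a₂ + a₃ ≤ b₁ + b₂ + b₃

module _ {Z : ℕ → ℕ → ℕ → Set} {a₁ a₂ a₃ : ℕ} (sol : MinimalSolution Z a₁ a₂ a₃) where
  open MinimalSolution sol

  private
    3≤length : 3 ≤ a₁ + a₂ + a₃
    3≤length = +-mono-≤ (+-mono-≤ positive₁ positive₂) positive₃

    unit-impossible : ∀ {b₁ b₂ b₃} → b₁ ≤ a₁ → b₂ ≤ a₂ → b₃ ≤ a₃ → b₁ + b₂ + b₃ ≡ 1 → ¬ Z b₁ b₂ b₃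
    unit-impossible p₁ p₂ p₃ Σb≡1 z
      with ≤-trans 3≤length (subst (a₁ + a₂ + a₃ ≤_) Σb≡1 (minimal p₁ p₂ p₃ (≤-reflexive (sym Σb≡1)) z))
    ... | s≤s ()

  MinimalSolution-¬unit₁ : ¬ Z 1 0 0
  MinimalSolution-¬unit₁ = unit-impossible positive₁ z≤n z≤n refl

  MinimalSolution-¬unit₂ : ¬ Z 0 1 0
  MinimalSolution-¬unit₂ = unit-impossible z≤n positive₂ z≤n refl

  MinimalSolution-¬unit₃ : ¬ Z 0 0 1
  MinimalSolution-¬unit₃ = unit-impossible z≤n z≤n positive₃ refl

  MinimalSolution-resp : ∀ {Z′ : ℕ → ℕ → ℕ → Set} →
    (∀ {b₁ b₂ b₃} → Z b₁ b₂ b₃ → Z′ b₁ b₂ b₃) → (∀ {b₁ b₂ b₃} → Z′ b₁ b₂ b₃ → Z b₁ b₂ b₃) →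
    MinimalSolution Z′ a₁ a₂ a₃
  MinimalSolution-resp to from = record
    { positive₁ = positive₁ ; positive₂ = positive₂ ; positive₃ = positive₃
    ; solution = to solution
    ; minimal = λ p₁ p₂ p₃ pos z → minimal p₁ p₂ p₃ pos (from z) }

  MinimalSolution-swap₁₂ : MinimalSolution (λ b₁ b₂ b₃ → Z b₂ b₁ b₃) a₂ a₁ a₃
  MinimalSolution-swap₁₂ = record
    { positive₁ = positive₂ ; positive₂ = positive₁ ; positive₃ = positive₃
    ; solution = solution
    ; minimal = λ {b₁} {b₂} {b₃} p₁ p₂ p₃ pos z →
        subst₂ _≤_ (+-swap₁₂ a₁ a₂ a₃) (+-swap₁₂ b₂ b₁ b₃)
          (minimal p₂ p₁ p₃ (subst (1 ≤_) (+-swap₁₂ b₁ b₂ b₃) pos) z) }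

  MinimalSolution-swap₂₃ : MinimalSolution (λ b₁ b₂ b₃ → Z b₁ b₃ b₂) a₁ a₃ a₂
  MinimalSolution-swap₂₃ = record
    { positive₁ = positive₁ ; positive₂ = positive₃ ; positive₃ = positive₂
    ; solution = solution
    ; minimal = λ {b₁} {b₂} {b₃} p₁ p₂ p₃ pos z →
        subst₂ _≤_ (+-swap₂₃ a₁ a₂ a₃) (+-swap₂₃ b₁ b₃ b₂)
          (minimal p₁ p₃ p₂ (subst (1 ≤_) (+-swap₂₃ b₁ b₂ b₃) pos) z) }

  -- Otherwise dividing a by gcd₃ a would give a shorter solution.
  MinimalSolution-coprime :
    (∀ d {b₁ b₂ b₃} → .{{NonZero d}} → Z (d * b₁) (d * b₂) (d * b₃) → Z b₁ b₂ b₃) →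
    gcd₃ a₁ a₂ a₃ ≡ 1
  MinimalSolution-coprime cancel = ≤-antisym d≤1 (ℕ.>-nonZero⁻¹ d)
    where
    d = gcd₃ a₁ a₂ a₃
    instance
      d≢0 : NonZero d
      d≢0 = ℕ.≢-nonZero (λ d≡0 → <⇒≢ positive₁ (sym (gcd[m,n]≡0⇒m≡0 d≡0)))
    q₁ q₂ q₃ : ℕ
    q₁ = a₁ / d
    q₂ = a₂ / d
    q₃ = a₃ / d
    e₁ : d * q₁ ≡ a₁
    e₁ = m*[n/m]≡n (gcd₃∣₁ a₁ a₂ a₃)
    e₂ : d * q₂ ≡ a₂
    e₂ = m*[n/m]≡n (gcd₃∣₂ a₁ a₂ a₃)
    e₃ : d * q₃ ≡ a₃
    e₃ = m*[n/m]≡n (gcd₃∣₃ a₁ a₂ a₃)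
    length≡ : d * (q₁ + q₂ + q₃) ≡ a₁ + a₂ + a₃
    length≡ = trans (*-distribˡ-+ d (q₁ + q₂) q₃)
      (cong₂ _+_ (trans (*-distribˡ-+ d q₁ q₂) (cong₂ _+_ e₁ e₂)) e₃)
    q≤a : ∀ {q a} → d * q ≡ a → q ≤ a
    q≤a {q} eq = subst (q ≤_) eq (m≤n*m q d)
    1≤Σq : 1 ≤ q₁ + q₂ + q₃
    1≤Σq = n≢0⇒n>0 (λ Σq≡0 → <⇒≢ (≤-trans (s≤s z≤n) 3≤length)
      (sym (trans (sym length≡) (trans (cong (d *_) Σq≡0) (*-zeroʳ d)))))
    Z-resp : ∀ {u₁ u₂ u₃ v₁ v₂ v₃} → u₁ ≡ v₁ → u₂ ≡ v₂ → u₃ ≡ v₃ → Z u₁ u₂ u₃ → Z v₁ v₂ v₃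
    Z-resp refl refl refl z = z
    shorter : a₁ + a₂ + a₃ ≤ q₁ + q₂ + q₃
    shorter = minimal (q≤a e₁) (q≤a e₂) (q≤a e₃) 1≤Σq
      (cancel d (Z-resp (sym e₁) (sym e₂) (sym e₃) solution))
    d≤1 : d ≤ 1
    d≤1 = *-cancelʳ-≤ d 1 (q₁ + q₂ + q₃) {{ℕ.>-nonZero 1≤Σq}}
      (subst₂ _≤_ (sym length≡) (sym (*-identityˡ _)) shorter)

combinationℤ : ℤ → ℤ → ℤ → ℕ → ℕ → ℕ → ℤ
combinationℤ c₁ c₂ c₃ b₁ b₂ b₃ = + b₁ ℤ.* c₁ ℤ.+ (+ b₂ ℤ.* c₂ ℤ.+ + b₃ ℤ.* c₃)

combination : Point → Point → Point → ℕ → ℕ → ℕ → Point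
combination (x₁ , y₁) (x₂ , y₂) (x₃ , y₃) b₁ b₂ b₃ =
  combinationℤ x₁ x₂ x₃ b₁ b₂ b₃ , combinationℤ y₁ y₂ y₃ b₁ b₂ b₃

ZeroCombinationℤ : ℤ → ℤ → ℤ → ℕ → ℕ → ℕ → Set
ZeroCombinationℤ c₁ c₂ c₃ b₁ b₂ b₃ = combinationℤ c₁ c₂ c₃ b₁ b₂ b₃ ≡ 0ℤ

ZeroCombination : Point → Point → Point → ℕ → ℕ → ℕ → Set
ZeroCombination s₁ s₂ s₃ b₁ b₂ b₃ = combination s₁ s₂ s₃ b₁ b₂ b₃ ≡ origin

-- The multiplicity is passed to the solver as an integer B, since + suc b reduces to 1ℤ + + b.
combinationℤ-suc₁ : ∀ c₁ c₂ c₃ b₁ b₂ b₃ →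
  c₁ ℤ.+ combinationℤ c₁ c₂ c₃ b₁ b₂ b₃ ≡ combinationℤ c₁ c₂ c₃ (suc b₁) b₂ b₃
combinationℤ-suc₁ c₁ c₂ c₃ b₁ b₂ b₃ = identity c₁ c₂ c₃ (+ b₁) (+ b₂) (+ b₃)
  where
  identity : ∀ (c₁ c₂ c₃ B₁ B₂ B₃ : ℤ) → c₁ ℤ.+ (B₁ ℤ.* c₁ ℤ.+ (B₂ ℤ.* c₂ ℤ.+ B₃ ℤ.* c₃))
    ≡ (+ 1 ℤ.+ B₁) ℤ.* c₁ ℤ.+ (B₂ ℤ.* c₂ ℤ.+ B₃ ℤ.* c₃)
  identity = ℤ-solve-∀

combinationℤ-suc₂ : ∀ c₁ c₂ c₃ b₁ b₂ b₃ →
  c₂ ℤ.+ combinationℤ c₁ c₂ c₃ b₁ b₂ b₃ ≡ combinationℤ c₁ c₂ c₃ b₁ (suc b₂) b₃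
combinationℤ-suc₂ c₁ c₂ c₃ b₁ b₂ b₃ = identity c₁ c₂ c₃ (+ b₁) (+ b₂) (+ b₃)
  where
  identity : ∀ (c₁ c₂ c₃ B₁ B₂ B₃ : ℤ) → c₂ ℤ.+ (B₁ ℤ.* c₁ ℤ.+ (B₂ ℤ.* c₂ ℤ.+ B₃ ℤ.* c₃))
    ≡ B₁ ℤ.* c₁ ℤ.+ ((+ 1 ℤ.+ B₂) ℤ.* c₂ ℤ.+ B₃ ℤ.* c₃)
  identity = ℤ-solve-∀

combinationℤ-suc₃ : ∀ c₁ c₂ c₃ b₁ b₂ b₃ →
  c₃ ℤ.+ combinationℤ c₁ c₂ c₃ b₁ b₂ b₃ ≡ combinationℤ c₁ c₂ c₃ b₁ b₂ (suc b₃)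
combinationℤ-suc₃ c₁ c₂ c₃ b₁ b₂ b₃ = identity c₁ c₂ c₃ (+ b₁) (+ b₂) (+ b₃)
  where
  identity : ∀ (c₁ c₂ c₃ B₁ B₂ B₃ : ℤ) → c₃ ℤ.+ (B₁ ℤ.* c₁ ℤ.+ (B₂ ℤ.* c₂ ℤ.+ B₃ ℤ.* c₃))
    ≡ B₁ ℤ.* c₁ ℤ.+ (B₂ ℤ.* c₂ ℤ.+ (+ 1 ℤ.+ B₃) ℤ.* c₃)
  identity = ℤ-solve-∀

combination-suc₁ : ∀ s₁ s₂ s₃ b₁ b₂ b₃ →
  s₁ ⊕ combination s₁ s₂ s₃ b₁ b₂ b₃ ≡ combination s₁ s₂ s₃ (suc b₁) b₂ b₃
combination-suc₁ (x₁ , y₁) (x₂ , y₂) (x₃ , y₃) b₁ b₂ b₃ =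
  cong₂ _,_ (combinationℤ-suc₁ x₁ x₂ x₃ b₁ b₂ b₃) (combinationℤ-suc₁ y₁ y₂ y₃ b₁ b₂ b₃)

combination-suc₂ : ∀ s₁ s₂ s₃ b₁ b₂ b₃ →
  s₂ ⊕ combination s₁ s₂ s₃ b₁ b₂ b₃ ≡ combination s₁ s₂ s₃ b₁ (suc b₂) b₃
combination-suc₂ (x₁ , y₁) (x₂ , y₂) (x₃ , y₃) b₁ b₂ b₃ =
  cong₂ _,_ (combinationℤ-suc₂ x₁ x₂ x₃ b₁ b₂ b₃) (combinationℤ-suc₂ y₁ y₂ y₃ b₁ b₂ b₃)

combination-suc₃ : ∀ s₁ s₂ s₃ b₁ b₂ b₃ →
  s₃ ⊕ combination s₁ s₂ s₃ b₁ b₂ b₃ ≡ combination s₁ s₂ s₃ b₁ b₂ (suc b₃)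
combination-suc₃ (x₁ , y₁) (x₂ , y₂) (x₃ , y₃) b₁ b₂ b₃ =
  cong₂ _,_ (combinationℤ-suc₃ x₁ x₂ x₃ b₁ b₂ b₃) (combinationℤ-suc₃ y₁ y₂ y₃ b₁ b₂ b₃)

combinationℤ-* : ∀ c₁ c₂ c₃ d b₁ b₂ b₃ →
  combinationℤ c₁ c₂ c₃ (d * b₁) (d * b₂) (d * b₃) ≡ + d ℤ.* combinationℤ c₁ c₂ c₃ b₁ b₂ b₃
combinationℤ-* c₁ c₂ c₃ d b₁ b₂ b₃ = begin
  combinationℤ c₁ c₂ c₃ (d * b₁) (d * b₂) (d * b₃)
    ≡⟨ cong₂ (λ u v → u ℤ.* c₁ ℤ.+ v) (ℤ.pos-* d b₁)
         (cong₂ (λ u v → u ℤ.* c₂ ℤ.+ v ℤ.* c₃) (ℤ.pos-* d b₂) (ℤ.pos-* d b₃)) ⟩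
  identity c₁ c₂ c₃ (+ d) (+ b₁) (+ b₂) (+ b₃)
  where
  open ≡-Reasoning
  identity : ∀ (c₁ c₂ c₃ D B₁ B₂ B₃ : ℤ) →
    D ℤ.* B₁ ℤ.* c₁ ℤ.+ (D ℤ.* B₂ ℤ.* c₂ ℤ.+ D ℤ.* B₃ ℤ.* c₃)
      ≡ D ℤ.* (B₁ ℤ.* c₁ ℤ.+ (B₂ ℤ.* c₂ ℤ.+ B₃ ℤ.* c₃))
  identity = ℤ-solve-∀

combinationℤ-swap₁₂ : ∀ c₁ c₂ c₃ b₁ b₂ b₃ →
  combinationℤ c₂ c₁ c₃ b₂ b₁ b₃ ≡ combinationℤ c₁ c₂ c₃ b₁ b₂ b₃
combinationℤ-swap₁₂ c₁ c₂ c₃ b₁ b₂ b₃ = identity c₁ c₂ c₃ (+ b₁) (+ b₂) (+ b₃)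
  where
  identity : ∀ (c₁ c₂ c₃ B₁ B₂ B₃ : ℤ) → B₂ ℤ.* c₂ ℤ.+ (B₁ ℤ.* c₁ ℤ.+ B₃ ℤ.* c₃)
    ≡ B₁ ℤ.* c₁ ℤ.+ (B₂ ℤ.* c₂ ℤ.+ B₃ ℤ.* c₃)
  identity = ℤ-solve-∀

combinationℤ-swap₂₃ : ∀ c₁ c₂ c₃ b₁ b₂ b₃ →
  combinationℤ c₁ c₃ c₂ b₁ b₃ b₂ ≡ combinationℤ c₁ c₂ c₃ b₁ b₂ b₃
combinationℤ-swap₂₃ c₁ c₂ c₃ b₁ b₂ b₃ = cong (ℤ._+_ (+ b₁ ℤ.* c₁)) (ℤ.+-comm (+ b₃ ℤ.* c₃) (+ b₂ ℤ.* c₂))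

combinationℤ-neg : ∀ c₁ c₂ c₃ b₁ b₂ b₃ →
  combinationℤ (- c₁) (- c₂) (- c₃) b₁ b₂ b₃ ≡ - combinationℤ c₁ c₂ c₃ b₁ b₂ b₃
combinationℤ-neg c₁ c₂ c₃ b₁ b₂ b₃ = identity c₁ c₂ c₃ (+ b₁) (+ b₂) (+ b₃)
  where
  identity : ∀ (c₁ c₂ c₃ B₁ B₂ B₃ : ℤ) → B₁ ℤ.* (- c₁) ℤ.+ (B₂ ℤ.* (- c₂) ℤ.+ B₃ ℤ.* (- c₃))
    ≡ - (B₁ ℤ.* c₁ ℤ.+ (B₂ ℤ.* c₂ ℤ.+ B₃ ℤ.* c₃))
  identity = ℤ-solve-∀

MinimalSolutionsBoundedBy : ℕ → ℤ → ℤ → ℤ → Set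
MinimalSolutionsBoundedBy B c₁ c₂ c₃ =
  ∀ {a₁ a₂ a₃} → MinimalSolution (ZeroCombinationℤ c₁ c₂ c₃) a₁ a₂ a₃ → a₁ + a₂ + a₃ ≤ B

module _ {B : ℕ} {c₁ c₂ c₃ : ℤ} (bounded : MinimalSolutionsBoundedBy B c₁ c₂ c₃) where

  bounded-swap₁₂ : MinimalSolutionsBoundedBy B c₂ c₁ c₃
  bounded-swap₁₂ {a₁} {a₂} {a₃} sol = subst (_≤ B) (+-swap₁₂ a₂ a₁ a₃)
    (bounded (MinimalSolution-resp (MinimalSolution-swap₁₂ sol)
      (λ {b₁} {b₂} {b₃} → trans (sym (combinationℤ-swap₁₂ c₁ c₂ c₃ b₁ b₂ b₃)))
      (λ {b₁} {b₂} {b₃} → trans (combinationℤ-swap₁₂ c₁ c₂ c₃ b₁ b₂ b₃))))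

  bounded-swap₂₃ : MinimalSolutionsBoundedBy B c₁ c₃ c₂
  bounded-swap₂₃ {a₁} {a₂} {a₃} sol = subst (_≤ B) (+-swap₂₃ a₁ a₃ a₂)
    (bounded (MinimalSolution-resp (MinimalSolution-swap₂₃ sol)
      (λ {b₁} {b₂} {b₃} → trans (sym (combinationℤ-swap₂₃ c₁ c₂ c₃ b₁ b₂ b₃)))
      (λ {b₁} {b₂} {b₃} → trans (combinationℤ-swap₂₃ c₁ c₂ c₃ b₁ b₂ b₃))))

  bounded-neg : MinimalSolutionsBoundedBy B (- c₁) (- c₂) (- c₃)
  bounded-neg sol = bounded (MinimalSolution-resp sol
    (λ {b₁} {b₂} {b₃} z → ℤ.neg-injective {j = 0ℤ} (trans (sym (combinationℤ-neg c₁ c₂ c₃ b₁ b₂ b₃)) z))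
    (λ {b₁} {b₂} {b₃} z → trans (combinationℤ-neg c₁ c₂ c₃ b₁ b₂ b₃) (cong -_ z)))

third-small-bound : ∀ {m a₁ a₂ a₃ u₁ u₂ u₃} .{{_ : NonZero u₁}} .{{_ : NonZero u₂}} →
  a₃ ≤ m → u₃ ≤ m → a₃ * u₃ ≡ a₁ * u₁ + a₂ * u₂ → a₁ + a₂ + a₃ ≤ m * m + m
third-small-bound {m} {a₁} {a₂} {a₃} {u₁} {u₂} {u₃} a₃≤m u₃≤m balance = begin
  a₁ + a₂ + a₃          ≤⟨ +-mono-≤ (+-mono-≤ (m≤m*n a₁ u₁) (m≤m*n a₂ u₂)) a₃≤m ⟩
  a₁ * u₁ + a₂ * u₂ + m ≡⟨ cong (_+ m) (sym balance) ⟩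
  a₃ * u₃ + m           ≤⟨ +-monoˡ-≤ m (*-mono-≤ a₃≤m u₃≤m) ⟩
  m * m + m             ∎
  where open ≤-Reasoning

first-two-small-bound : ∀ {m a₁ a₂ a₃ u₁ u₂ u₃} .{{_ : NonZero u₃}} →
  a₁ < u₃ → a₂ < u₃ → u₁ ≤ m → u₂ ≤ m → u₃ ≤ m → a₃ * u₃ ≡ a₁ * u₁ + a₂ * u₂ → a₁ + a₂ + a₃ ≤ 4 * m
first-two-small-bound {m} {a₁} {a₂} {a₃} {u₁} {u₂} {u₃} a₁<u₃ a₂<u₃ u₁≤m u₂≤m u₃≤m balance = begin
  a₁ + a₂ + a₃          ≤⟨ +-mono-≤ a₁+a₂≤2m a₃≤2m ⟩
  2 * m + 2 * m         ≡⟨ 2m+2m≡4m m ⟩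
  4 * m                 ∎
  where
  open ≤-Reasoning
  2m+2m≡4m : ∀ m → 2 * m + 2 * m ≡ 4 * m
  2m+2m≡4m = ℕ-solve-∀
  a₁+a₂≤2u₃ : a₁ + a₂ ≤ 2 * u₃
  a₁+a₂≤2u₃ = subst (a₁ + a₂ ≤_) (cong (_+_ u₃) (sym (+-identityʳ u₃)))
    (+-mono-≤ (<⇒≤ a₁<u₃) (<⇒≤ a₂<u₃))
  a₁+a₂≤2m : a₁ + a₂ ≤ 2 * m
  a₁+a₂≤2m = ≤-trans a₁+a₂≤2u₃ (*-monoʳ-≤ 2 u₃≤m)
  a₃≤2m : a₃ ≤ 2 * m
  a₃≤2m = *-cancelʳ-≤ a₃ (2 * m) u₃ (begin
    a₃ * u₃               ≡⟨ balance ⟩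
    a₁ * u₁ + a₂ * u₂     ≤⟨ +-mono-≤ (*-monoʳ-≤ a₁ u₁≤m) (*-monoʳ-≤ a₂ u₂≤m) ⟩
    a₁ * m + a₂ * m       ≡⟨ sym (*-distribʳ-+ m a₁ a₂) ⟩
    (a₁ + a₂) * m         ≤⟨ *-monoˡ-≤ m a₁+a₂≤2u₃ ⟩
    2 * u₃ * m            ≡⟨ *-right-comm 2 u₃ m ⟩
    2 * m * u₃            ∎)
    where
    *-right-comm : ∀ a b c → a * b * c ≡ a * c * b
    *-right-comm = ℕ-solve-∀

-- Either a₃ < u₁ or a₃ < u₂, and then a₁ + a₂ ≤ a₃u₃ ≤ m²; or one of the two exchanges fits
-- into a; or a₁, a₂ < u₃, and then a₃u₃ ≤ (a₁ + a₂)m < 2u₃m bounds a₃ by 2m.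
balanced-triple-bound : ∀ {m a₁ a₂ a₃ u₁ u₂ u₃}
  .{{_ : NonZero u₁}} .{{_ : NonZero u₂}} .{{_ : NonZero u₃}} →
  u₁ ≤ m → u₂ ≤ m → u₃ ≤ m → a₃ * u₃ ≡ a₁ * u₁ + a₂ * u₂ →
  (u₃ ≤ a₁ → u₁ ≤ a₃ → a₁ + a₂ + a₃ ≤ u₃ + u₁) →
  (u₃ ≤ a₂ → u₂ ≤ a₃ → a₁ + a₂ + a₃ ≤ u₃ + u₂) →
  a₁ + a₂ + a₃ ≤ m * m + 4 * m
balanced-triple-bound {m} {a₁} {a₂} {a₃} {u₁} {u₂} {u₃} u₁≤m u₂≤m u₃≤m balance exchange₁₃ exchange₂₃ =
  bound
  where
  third-small : a₃ ≤ m → a₁ + a₂ + a₃ ≤ m * m + 4 * m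
  third-small a₃≤m = ≤-trans (third-small-bound {a₁ = a₁} {a₂} {u₁ = u₁} {u₂} a₃≤m u₃≤m balance)
    (+-monoʳ-≤ (m * m) (m≤m+n m (3 * m)))
  pair : ∀ {u v} → u ≤ m → v ≤ m → u + v ≤ m * m + 4 * m
  pair u≤m v≤m = ≤-trans (+-mono-≤ u≤m v≤m)
    (≤-trans (+-monoʳ-≤ m (m≤m+n m (2 * m))) (m≤n+m (4 * m) (m * m)))
  bound : a₁ + a₂ + a₃ ≤ m * m + 4 * m
  bound with u₁ ≤? a₃ | u₂ ≤? a₃ | u₃ ≤? a₁ | u₃ ≤? a₂
  ... | no u₁≰a₃ | _ | _ | _ = third-small (≤-trans (<⇒≤ (≰⇒> u₁≰a₃)) u₁≤m)
  ... | yes _ | no u₂≰a₃ | _ | _ = third-small (≤-trans (<⇒≤ (≰⇒> u₂≰a₃)) u₂≤m)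
  ... | yes u₁≤a₃ | yes _ | yes u₃≤a₁ | _ = ≤-trans (exchange₁₃ u₃≤a₁ u₁≤a₃) (pair u₃≤m u₁≤m)
  ... | yes _ | yes u₂≤a₃ | no _ | yes u₃≤a₂ = ≤-trans (exchange₂₃ u₃≤a₂ u₂≤a₃) (pair u₃≤m u₂≤m)
  ... | yes _ | yes _ | no u₃≰a₁ | no u₃≰a₂ =
    ≤-trans (first-two-small-bound {a₃ = a₃} (≰⇒> u₃≰a₁) (≰⇒> u₃≰a₂) u₁≤m u₂≤m u₃≤m balance)
      (m≤n+m (4 * m) (m * m))

bounded⁺⁺⁻ : ∀ {m u₁ u₂ u₃} → suc u₁ ≤ m → suc u₂ ≤ m → suc u₃ ≤ m →
  MinimalSolutionsBoundedBy (m * m + 4 * m) +[1+ u₁ ] +[1+ u₂ ] -[1+ u₃ ]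
bounded⁺⁺⁻ {m} {u₁} {u₂} {u₃} u₁<m u₂<m u₃<m {a₁} {a₂} {a₃} sol =
  balanced-triple-bound u₁<m u₂<m u₃<m balance exchange₁₃ exchange₂₃
  where
  open MinimalSolution sol
  U₁ U₂ U₃ : ℕ
  U₁ = suc u₁
  U₂ = suc u₂
  U₃ = suc u₃
  rearrange : ∀ (A₁ A₂ A₃ U₁ U₂ U₃ : ℤ) →
    A₃ ℤ.* U₃ ℤ.- (A₁ ℤ.* U₁ ℤ.+ A₂ ℤ.* U₂) ≡ - (A₁ ℤ.* U₁ ℤ.+ (A₂ ℤ.* U₂ ℤ.+ A₃ ℤ.* (- U₃)))
  rearrange = ℤ-solve-∀
  balance : a₃ * U₃ ≡ a₁ * U₁ + a₂ * U₂
  balance = ℤ.+-injective (begin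
    + (a₃ * U₃)                     ≡⟨ ℤ.pos-* a₃ U₃ ⟩
    + a₃ ℤ.* + U₃                   ≡⟨ ℤ.i-j≡0⇒i≡j _ _ (trans
                                         (rearrange (+ a₁) (+ a₂) (+ a₃) (+ U₁) (+ U₂) (+ U₃))
                                         (cong -_ solution)) ⟩
    + a₁ ℤ.* + U₁ ℤ.+ + a₂ ℤ.* + U₂ ≡⟨ cong₂ ℤ._+_ (sym (ℤ.pos-* a₁ U₁)) (sym (ℤ.pos-* a₂ U₂)) ⟩
    + (a₁ * U₁ + a₂ * U₂)           ∎)
    where open ≡-Reasoning
  exchange₁₃-vanishes : ∀ (p q r : ℤ) → p ℤ.* q ℤ.+ (0ℤ ℤ.* r ℤ.+ q ℤ.* (- p)) ≡ 0ℤ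
  exchange₁₃-vanishes = ℤ-solve-∀
  exchange₂₃-vanishes : ∀ (p q r : ℤ) → 0ℤ ℤ.* r ℤ.+ (p ℤ.* q ℤ.+ q ℤ.* (- p)) ≡ 0ℤ
  exchange₂₃-vanishes = ℤ-solve-∀
  exchange₁₃ : U₃ ≤ a₁ → U₁ ≤ a₃ → a₁ + a₂ + a₃ ≤ U₃ + U₁
  exchange₁₃ U₃≤a₁ U₁≤a₃ = subst (a₁ + a₂ + a₃ ≤_) (cong (_+ U₁) (+-identityʳ U₃))
    (minimal U₃≤a₁ z≤n U₁≤a₃ (s≤s z≤n) (exchange₁₃-vanishes (+ U₃) (+ U₁) (+ U₂)))
  exchange₂₃ : U₃ ≤ a₂ → U₂ ≤ a₃ → a₁ + a₂ + a₃ ≤ U₃ + U₂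
  exchange₂₃ U₃≤a₂ U₂≤a₃ = minimal z≤n U₃≤a₂ U₂≤a₃ (s≤s z≤n) (exchange₂₃-vanishes (+ U₃) (+ U₂) (+ U₁))

bounded⁺⁺⁺ : ∀ {B u₁ u₂ u₃} → MinimalSolutionsBoundedBy B +[1+ u₁ ] +[1+ u₂ ] +[1+ u₃ ]
bounded⁺⁺⁺ {B} {u₁} {u₂} {u₃} {a₁} {a₂} {a₃} sol =
  ⊥-elim (<⇒≢ (*-mono-≤ positive₁ (s≤s z≤n)) (sym (m+n≡0⇒m≡0 _ combination≡0)))
  where
  open MinimalSolution sol
  combination≡0 : a₁ * suc u₁ + (a₂ * suc u₂ + a₃ * suc u₃) ≡ 0
  combination≡0 = ℤ.+-injective
    (trans (cong₂ ℤ._+_ (ℤ.pos-* a₁ _) (cong₂ ℤ._+_ (ℤ.pos-* a₂ _) (ℤ.pos-* a₃ _))) solution)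

-- A coefficient 0 is excluded by minimality; otherwise, up to permuting and negating the
-- coefficients, either all have the same sign or the signs are (+, +, −).
minimalSolutions-bounded : ∀ {m} {c₁ c₂ c₃ : ℤ} → ∣ c₁ ∣ ≤ m → ∣ c₂ ∣ ≤ m → ∣ c₃ ∣ ≤ m →
  MinimalSolutionsBoundedBy (m * m + 4 * m) c₁ c₂ c₃
minimalSolutions-bounded {c₁ = +0} _ _ _ sol = ⊥-elim (MinimalSolution-¬unit₁ sol refl)
minimalSolutions-bounded {c₂ = +0} _ _ _ sol = ⊥-elim (MinimalSolution-¬unit₂ sol refl)
minimalSolutions-bounded {c₃ = +0} _ _ _ sol = ⊥-elim (MinimalSolution-¬unit₃ sol refl)
minimalSolutions-bounded {c₁ = +[1+ _ ]} {+[1+ _ ]} {+[1+ _ ]} _ _ _ = bounded⁺⁺⁺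
minimalSolutions-bounded {c₁ = -[1+ _ ]} { -[1+ _ ]} { -[1+ _ ]} _ _ _ = bounded-neg bounded⁺⁺⁺
minimalSolutions-bounded {c₁ = +[1+ _ ]} {+[1+ _ ]} { -[1+ _ ]} p q r = bounded⁺⁺⁻ p q r
minimalSolutions-bounded {c₁ = -[1+ _ ]} { -[1+ _ ]} {+[1+ _ ]} p q r = bounded-neg (bounded⁺⁺⁻ p q r)
minimalSolutions-bounded {c₁ = +[1+ _ ]} { -[1+ _ ]} {+[1+ _ ]} p q r = bounded-swap₂₃ (bounded⁺⁺⁻ p r q)
minimalSolutions-bounded {c₁ = -[1+ _ ]} {+[1+ _ ]} { -[1+ _ ]} p q r =
  bounded-neg (bounded-swap₂₃ (bounded⁺⁺⁻ p r q))
minimalSolutions-bounded {c₁ = -[1+ _ ]} {+[1+ _ ]} {+[1+ _ ]} p q r =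
  bounded-swap₁₂ (bounded-swap₂₃ (bounded⁺⁺⁻ q r p))
minimalSolutions-bounded {c₁ = +[1+ _ ]} { -[1+ _ ]} { -[1+ _ ]} p q r =
  bounded-neg (bounded-swap₁₂ (bounded-swap₂₃ (bounded⁺⁺⁻ q r p)))

-- Cramer's rule

det : Point → Point → ℤ
det (x₁ , y₁) (x₂ , y₂) = x₁ ℤ.* y₂ ℤ.- x₂ ℤ.* y₁

module _ (x₁ y₁ x₂ y₂ x₃ y₃ : ℤ) (b₁ b₂ b₃ : ℕ) where
  private
    X Y : ℤ
    X = combinationℤ x₁ x₂ x₃ b₁ b₂ b₃
    Y = combinationℤ y₁ y₂ y₃ b₁ b₂ b₃

  cramer₁₂ : + b₁ ℤ.* det (x₁ , y₁) (x₃ , y₃) ℤ.+ + b₂ ℤ.* det (x₂ , y₂) (x₃ , y₃) ≡ y₃ ℤ.* X ℤ.- x₃ ℤ.* Y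
  cramer₁₂ = identity x₁ y₁ x₂ y₂ x₃ y₃ (+ b₁) (+ b₂) (+ b₃)
    where
    identity : ∀ (x₁ y₁ x₂ y₂ x₃ y₃ B₁ B₂ B₃ : ℤ) →
      B₁ ℤ.* (x₁ ℤ.* y₃ ℤ.- x₃ ℤ.* y₁) ℤ.+ B₂ ℤ.* (x₂ ℤ.* y₃ ℤ.- x₃ ℤ.* y₂)
        ≡ y₃ ℤ.* (B₁ ℤ.* x₁ ℤ.+ (B₂ ℤ.* x₂ ℤ.+ B₃ ℤ.* x₃)) ℤ.- x₃ ℤ.* (B₁ ℤ.* y₁ ℤ.+ (B₂ ℤ.* y₂ ℤ.+ B₃ ℤ.* y₃))
    identity = ℤ-solve-∀

  cramer₁₃ : + b₁ ℤ.* det (x₁ , y₁) (x₂ , y₂) ℤ.- + b₃ ℤ.* det (x₂ , y₂) (x₃ , y₃) ≡ y₂ ℤ.* X ℤ.- x₂ ℤ.* Y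
  cramer₁₃ = identity x₁ y₁ x₂ y₂ x₃ y₃ (+ b₁) (+ b₂) (+ b₃)
    where
    identity : ∀ (x₁ y₁ x₂ y₂ x₃ y₃ B₁ B₂ B₃ : ℤ) →
      B₁ ℤ.* (x₁ ℤ.* y₂ ℤ.- x₂ ℤ.* y₁) ℤ.- B₃ ℤ.* (x₂ ℤ.* y₃ ℤ.- x₃ ℤ.* y₂)
        ≡ y₂ ℤ.* (B₁ ℤ.* x₁ ℤ.+ (B₂ ℤ.* x₂ ℤ.+ B₃ ℤ.* x₃)) ℤ.- x₂ ℤ.* (B₁ ℤ.* y₁ ℤ.+ (B₂ ℤ.* y₂ ℤ.+ B₃ ℤ.* y₃))
    identity = ℤ-solve-∀

  cramer₂₃ : + b₂ ℤ.* det (x₁ , y₁) (x₂ , y₂) ℤ.+ + b₃ ℤ.* det (x₁ , y₁) (x₃ , y₃) ≡ x₁ ℤ.* Y ℤ.- y₁ ℤ.* X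
  cramer₂₃ = identity x₁ y₁ x₂ y₂ x₃ y₃ (+ b₁) (+ b₂) (+ b₃)
    where
    identity : ∀ (x₁ y₁ x₂ y₂ x₃ y₃ B₁ B₂ B₃ : ℤ) →
      B₂ ℤ.* (x₁ ℤ.* y₂ ℤ.- x₂ ℤ.* y₁) ℤ.+ B₃ ℤ.* (x₁ ℤ.* y₃ ℤ.- x₃ ℤ.* y₁)
        ≡ x₁ ℤ.* (B₁ ℤ.* y₁ ℤ.+ (B₂ ℤ.* y₂ ℤ.+ B₃ ℤ.* y₃)) ℤ.- y₁ ℤ.* (B₁ ℤ.* x₁ ℤ.+ (B₂ ℤ.* x₂ ℤ.+ B₃ ℤ.* x₃))
    identity = ℤ-solve-∀

i+j≡0⇒∣i∣≡∣j∣ : ∀ i j → i ℤ.+ j ≡ 0ℤ → ∣ i ∣ ≡ ∣ j ∣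
i+j≡0⇒∣i∣≡∣j∣ i j i+j≡0 = trans (cong ∣_∣ i≡-j) (ℤ.∣-i∣≡∣i∣ j)
  where
  identity : ∀ i j → i ≡ i ℤ.+ j ℤ.- j
  identity = ℤ-solve-∀
  i≡-j : i ≡ - j
  i≡-j = trans (identity i j) (trans (cong (ℤ._- j) i+j≡0) (ℤ.+-identityˡ (- j)))

i-j≡0⇒∣i∣≡∣j∣ : ∀ i j → i ℤ.- j ≡ 0ℤ → ∣ i ∣ ≡ ∣ j ∣
i-j≡0⇒∣i∣≡∣j∣ i j i-j≡0 = cong ∣_∣ (ℤ.i-j≡0⇒i≡j i j i-j≡0)

solution⇒proportional : ∀ s₁ s₂ s₃ b₁ b₂ b₃ → ZeroCombination s₁ s₂ s₃ b₁ b₂ b₃ →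
    b₁ * ∣ det s₁ s₃ ∣ ≡ b₂ * ∣ det s₂ s₃ ∣
  × b₁ * ∣ det s₁ s₂ ∣ ≡ b₃ * ∣ det s₂ s₃ ∣
  × b₂ * ∣ det s₁ s₂ ∣ ≡ b₃ * ∣ det s₁ s₃ ∣
solution⇒proportional s₁@(x₁ , y₁) s₂@(x₂ , y₂) s₃@(x₃ , y₃) b₁ b₂ b₃ z =
    unsign b₁ D₂ b₂ D₁ (i+j≡0⇒∣i∣≡∣j∣ (+ b₁ ℤ.* D₂) (+ b₂ ℤ.* D₁)
      (trans (cramer₁₂ x₁ y₁ x₂ y₂ x₃ y₃ b₁ b₂ b₃) (vanish y₃ x₃ X≡0 Y≡0)))
  , unsign b₁ D₃ b₃ D₁ (i-j≡0⇒∣i∣≡∣j∣ (+ b₁ ℤ.* D₃) (+ b₃ ℤ.* D₁)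
      (trans (cramer₁₃ x₁ y₁ x₂ y₂ x₃ y₃ b₁ b₂ b₃) (vanish y₂ x₂ X≡0 Y≡0)))
  , unsign b₂ D₃ b₃ D₂ (i+j≡0⇒∣i∣≡∣j∣ (+ b₂ ℤ.* D₃) (+ b₃ ℤ.* D₂)
      (trans (cramer₂₃ x₁ y₁ x₂ y₂ x₃ y₃ b₁ b₂ b₃) (vanish x₁ y₁ Y≡0 X≡0)))
  where
  D₁ D₂ D₃ : ℤ
  D₁ = det s₂ s₃
  D₂ = det s₁ s₃
  D₃ = det s₁ s₂
  X≡0 = cong proj₁ z
  Y≡0 = cong proj₂ z
  vanish : ∀ (u v : ℤ) {X Y} → X ≡ 0ℤ → Y ≡ 0ℤ → u ℤ.* X ℤ.- v ℤ.* Y ≡ 0ℤ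
  vanish u v refl refl = cong₂ ℤ._-_ (ℤ.*-zeroʳ u) (ℤ.*-zeroʳ v)
  unsign : ∀ b D b′ D′ → ∣ + b ℤ.* D ∣ ≡ ∣ + b′ ℤ.* D′ ∣ → b * ∣ D ∣ ≡ b′ * ∣ D′ ∣
  unsign b D b′ D′ eq = trans (sym (ℤ.abs-* (+ b) D)) (trans eq (ℤ.abs-* (+ b′) D′))

solution-proportional-minors : ∀ s₁ s₂ s₃ b₁ b₂ b₃ → ZeroCombination s₁ s₂ s₃ b₁ b₂ b₃ →
  let P₁ = ∣ det s₂ s₃ ∣ ; P₂ = ∣ det s₁ s₃ ∣ ; P₃ = ∣ det s₁ s₂ ∣ in
    b₁ * gcd₃ P₁ P₂ P₃ ≡ gcd₃ b₁ b₂ b₃ * P₁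
  × b₂ * gcd₃ P₁ P₂ P₃ ≡ gcd₃ b₁ b₂ b₃ * P₂
  × b₃ * gcd₃ P₁ P₂ P₃ ≡ gcd₃ b₁ b₂ b₃ * P₃
solution-proportional-minors s₁ s₂ s₃ b₁ b₂ b₃ z =
    *-gcd₃-proportional b₁ P₁ b₁ b₂ b₃ P₁ P₂ P₃ refl e₁₂ e₁₃
  , *-gcd₃-proportional b₂ P₂ b₁ b₂ b₃ P₁ P₂ P₃ (sym e₁₂) refl e₂₃
  , *-gcd₃-proportional b₃ P₃ b₁ b₂ b₃ P₁ P₂ P₃ (sym e₁₃) (sym e₂₃) refl
  where
  P₁ P₂ P₃ : ℕ
  P₁ = ∣ det s₂ s₃ ∣
  P₂ = ∣ det s₁ s₃ ∣
  P₃ = ∣ det s₁ s₂ ∣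
  proportional = solution⇒proportional s₁ s₂ s₃ b₁ b₂ b₃ z
  e₁₂ = proj₁ proportional
  e₁₃ = proj₁ (proj₂ proportional)
  e₂₃ = proj₂ (proj₂ proportional)

ZeroCombination-cancel : ∀ s₁ s₂ s₃ d {b₁ b₂ b₃} → .{{NonZero d}} →
  ZeroCombination s₁ s₂ s₃ (d * b₁) (d * b₂) (d * b₃) → ZeroCombination s₁ s₂ s₃ b₁ b₂ b₃
ZeroCombination-cancel (x₁ , y₁) (x₂ , y₂) (x₃ , y₃) d {b₁} {b₂} {b₃} z =
  cong₂ _,_ (cancel (combinationℤ-* x₁ x₂ x₃ d b₁ b₂ b₃) (cong proj₁ z))
            (cancel (combinationℤ-* y₁ y₂ y₃ d b₁ b₂ b₃) (cong proj₂ z))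
  where
  cancel : ∀ {u v} → u ≡ + d ℤ.* v → u ≡ 0ℤ → v ≡ 0ℤ
  cancel u≡dv u≡0 with ℤ.i*j≡0⇒i≡0∨j≡0 (+ d) (trans (sym u≡dv) u≡0)
  ... | inj₁ d≡0 = ⊥-elim (ℕ.≢-nonZero⁻¹ d (ℤ.+-injective d≡0))
  ... | inj₂ v≡0 = v≡0

minimalSolution*gcd₃≡minors : ∀ s₁ s₂ s₃ {a₁ a₂ a₃} →
  MinimalSolution (ZeroCombination s₁ s₂ s₃) a₁ a₂ a₃ →
  let P₁ = ∣ det s₂ s₃ ∣ ; P₂ = ∣ det s₁ s₃ ∣ ; P₃ = ∣ det s₁ s₂ ∣ in
  a₁ * gcd₃ P₁ P₂ P₃ ≡ P₁ × a₂ * gcd₃ P₁ P₂ P₃ ≡ P₂ × a₃ * gcd₃ P₁ P₂ P₃ ≡ P₃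
minimalSolution*gcd₃≡minors s₁ s₂ s₃ {a₁} {a₂} {a₃} sol =
  trans e₁ (coprime _) , trans e₂ (coprime _) , trans e₃ (coprime _)
  where
  scaled = solution-proportional-minors s₁ s₂ s₃ a₁ a₂ a₃ (MinimalSolution.solution sol)
  e₁ = proj₁ scaled
  e₂ = proj₁ (proj₂ scaled)
  e₃ = proj₂ (proj₂ scaled)
  coprime : ∀ P → gcd₃ a₁ a₂ a₃ * P ≡ P
  coprime P =
    trans (cong (_* P) (MinimalSolution-coprime sol (ZeroCombination-cancel s₁ s₂ s₃))) (*-identityˡ P)

cramer-solution : ∀ s₁ s₂ s₃ {p₁ p₂ p₃} →
  det s₂ s₃ ≡ + p₁ → det s₁ s₃ ≡ - + p₂ → det s₁ s₂ ≡ + p₃ → ZeroCombination s₁ s₂ s₃ p₁ p₂ p₃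
cramer-solution s₁@(x₁ , y₁) s₂@(x₂ , y₂) s₃@(x₃ , y₃) {p₁} {p₂} {p₃} e₁ e₂ e₃ =
  cong₂ _,_ (trans (substitute x₁ x₂ x₃) (identityˣ x₁ y₁ x₂ y₂ x₃ y₃))
            (trans (substitute y₁ y₂ y₃) (identityʸ x₁ y₁ x₂ y₂ x₃ y₃))
  where
  substitute : ∀ c₁ c₂ c₃ →
    combinationℤ c₁ c₂ c₃ p₁ p₂ p₃ ≡ det s₂ s₃ ℤ.* c₁ ℤ.+ (- det s₁ s₃ ℤ.* c₂ ℤ.+ det s₁ s₂ ℤ.* c₃)
  substitute c₁ c₂ c₃ = cong₂ (λ u v → u ℤ.* c₁ ℤ.+ v) (sym e₁)
    (cong₂ (λ u v → u ℤ.* c₂ ℤ.+ v ℤ.* c₃)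
      (trans (sym (ℤ.neg-involutive (+ p₂))) (cong -_ (sym e₂))) (sym e₃))
  identityˣ : ∀ x₁ y₁ x₂ y₂ x₃ y₃ → (x₂ ℤ.* y₃ ℤ.- x₃ ℤ.* y₂) ℤ.* x₁ ℤ.+
    (- (x₁ ℤ.* y₃ ℤ.- x₃ ℤ.* y₁) ℤ.* x₂ ℤ.+ (x₁ ℤ.* y₂ ℤ.- x₂ ℤ.* y₁) ℤ.* x₃) ≡ 0ℤ
  identityˣ = ℤ-solve-∀
  identityʸ : ∀ x₁ y₁ x₂ y₂ x₃ y₃ → (x₂ ℤ.* y₃ ℤ.- x₃ ℤ.* y₂) ℤ.* y₁ ℤ.+
    (- (x₁ ℤ.* y₃ ℤ.- x₃ ℤ.* y₁) ℤ.* y₂ ℤ.+ (x₁ ℤ.* y₂ ℤ.- x₂ ℤ.* y₁) ℤ.* y₃) ≡ 0ℤ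
  identityʸ = ℤ-solve-∀

multiple⇒longer : ∀ k p₁ p₂ p₃ →
  1 ≤ k * p₁ + k * p₂ + k * p₃ → p₁ + p₂ + p₃ ≤ k * p₁ + k * p₂ + k * p₃
multiple⇒longer k p₁ p₂ p₃ 1≤Σb =
  subst (p₁ + p₂ + p₃ ≤_) (sym Σb≡) (m≤n*m (p₁ + p₂ + p₃) k {{ℕ.≢-nonZero k≢0}})
  where
  Σb≡ : k * p₁ + k * p₂ + k * p₃ ≡ k * (p₁ + p₂ + p₃)
  Σb≡ = sym (trans (*-distribˡ-+ k (p₁ + p₂) p₃) (cong (_+ k * p₃) (*-distribˡ-+ k p₁ p₂)))
  k≢0 : k ≢ 0
  k≢0 k≡0 = <⇒≢ 1≤Σb (sym (trans Σb≡ (cong (_* (p₁ + p₂ + p₃)) k≡0)))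

-- By the Cramer relations every solution is gcd₃ b times (p₁, p₂, p₃).
minimalSolution-from-minors : ∀ s₁ s₂ s₃ {p₁ p₂ p₃} →
  det s₂ s₃ ≡ + p₁ → det s₁ s₃ ≡ - + p₂ → det s₁ s₂ ≡ + p₃ →
  1 ≤ p₁ → 1 ≤ p₂ → 1 ≤ p₃ → gcd₃ p₁ p₂ p₃ ≡ 1 → MinimalSolution (ZeroCombination s₁ s₂ s₃) p₁ p₂ p₃
minimalSolution-from-minors s₁ s₂ s₃ {p₁} {p₂} {p₃} e₁ e₂ e₃ 1≤p₁ 1≤p₂ 1≤p₃ coprime = record
  { positive₁ = 1≤p₁ ; positive₂ = 1≤p₂ ; positive₃ = 1≤p₃
  ; solution = cramer-solution s₁ s₂ s₃ e₁ e₂ e₃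
  ; minimal = λ {b₁} {b₂} {b₃} _ _ _ 1≤Σb z → minimal b₁ b₂ b₃ 1≤Σb z }
  where
  ∣D₁∣≡ : ∣ det s₂ s₃ ∣ ≡ p₁
  ∣D₁∣≡ = cong ∣_∣ e₁
  ∣D₂∣≡ : ∣ det s₁ s₃ ∣ ≡ p₂
  ∣D₂∣≡ = trans (cong ∣_∣ e₂) (ℤ.∣-i∣≡∣i∣ (+ p₂))
  ∣D₃∣≡ : ∣ det s₁ s₂ ∣ ≡ p₃
  ∣D₃∣≡ = cong ∣_∣ e₃
  g≡1 : gcd₃ (∣ det s₂ s₃ ∣) (∣ det s₁ s₃ ∣) (∣ det s₁ s₂ ∣) ≡ 1
  g≡1 = trans (cong₂ gcd ∣D₁∣≡ (cong₂ gcd ∣D₂∣≡ ∣D₃∣≡)) coprime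
  minimal : ∀ b₁ b₂ b₃ → 1 ≤ b₁ + b₂ + b₃ → ZeroCombination s₁ s₂ s₃ b₁ b₂ b₃ →
    p₁ + p₂ + p₃ ≤ b₁ + b₂ + b₃
  minimal b₁ b₂ b₃ 1≤Σb z = subst₂ (λ u v → p₁ + p₂ + p₃ ≤ u + v) (sym (proj₁ bᵢ≡)) (sym (proj₂ bᵢ≡))
    (multiple⇒longer k p₁ p₂ p₃ (subst₂ (λ u v → 1 ≤ u + v) (proj₁ bᵢ≡) (proj₂ bᵢ≡) 1≤Σb))
    where
    k = gcd₃ b₁ b₂ b₃
    scaled = solution-proportional-minors s₁ s₂ s₃ b₁ b₂ b₃ z
    unscale : ∀ b {P p} →
      b * gcd₃ (∣ det s₂ s₃ ∣) (∣ det s₁ s₃ ∣) (∣ det s₁ s₂ ∣) ≡ k * P → P ≡ p → b ≡ k * p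
    unscale b eq refl = trans (sym (*-identityʳ b)) (trans (cong (b *_) (sym g≡1)) eq)
    bᵢ≡ : b₁ + b₂ ≡ k * p₁ + k * p₂ × b₃ ≡ k * p₃
    bᵢ≡ = cong₂ _+_ (unscale b₁ (proj₁ scaled) ∣D₁∣≡) (unscale b₂ (proj₁ (proj₂ scaled)) ∣D₂∣≡)
        , unscale b₃ (proj₂ (proj₂ scaled)) ∣D₃∣≡

-- Collinear points

∣∣≤-InRange : ∀ {m x} → InRange m x → ∣ x ∣ ≤ m
∣∣≤-InRange {m} {+ n} (_ , ℤ.+≤+ n≤m) = n≤m
∣∣≤-InRange {suc m} { -[1+ n ]} (ℤ.-≤- n≤m , _) = s≤s n≤m
∣∣≤-InRange {zero} { -[1+ n ]} (() , _)

proportional-zero : ∀ {c u} d {v} → c ≢ 0ℤ → c ℤ.* u ≡ d ℤ.* v → v ≡ 0ℤ → u ≡ 0ℤ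
proportional-zero {c} d c≢0 cu≡dv refl with ℤ.i*j≡0⇒i≡0∨j≡0 c (trans cu≡dv (ℤ.*-zeroʳ d))
... | inj₁ c≡0 = ⊥-elim (c≢0 c≡0)
... | inj₂ u≡0 = u≡0

collinear-cross : ∀ x₁ y₁ x₂ y₂ x₃ y₃ b₁ b₂ b₃ →
  det (x₁ , y₁) (x₂ , y₂) ≡ 0ℤ → det (x₁ , y₁) (x₃ , y₃) ≡ 0ℤ →
  x₁ ℤ.* combinationℤ y₁ y₂ y₃ b₁ b₂ b₃ ≡ y₁ ℤ.* combinationℤ x₁ x₂ x₃ b₁ b₂ b₃
collinear-cross x₁ y₁ x₂ y₂ x₃ y₃ b₁ b₂ b₃ d₁₂≡0 d₁₃≡0 = ℤ.i-j≡0⇒i≡j _ _ (begin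
  x₁ ℤ.* combinationℤ y₁ y₂ y₃ b₁ b₂ b₃ ℤ.- y₁ ℤ.* combinationℤ x₁ x₂ x₃ b₁ b₂ b₃
    ≡⟨ sym (cramer₂₃ x₁ y₁ x₂ y₂ x₃ y₃ b₁ b₂ b₃) ⟩
  + b₂ ℤ.* det (x₁ , y₁) (x₂ , y₂) ℤ.+ + b₃ ℤ.* det (x₁ , y₁) (x₃ , y₃)
    ≡⟨ cong₂ ℤ._+_ (trans (cong (+ b₂ ℤ.*_) d₁₂≡0) (ℤ.*-zeroʳ (+ b₂)))
                   (trans (cong (+ b₃ ℤ.*_) d₁₃≡0) (ℤ.*-zeroʳ (+ b₃))) ⟩
  0ℤ ∎)
  where open ≡-Reasoning

-- For collinear points a combination vanishes as soon as its coordinate in a direction where s₁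
-- is nonzero does, so minimality reduces to one integer equation.
collinear-minimalSolution-bound : ∀ {m s₁ s₂ s₃ a₁ a₂ a₃} → InBox m s₁ → InBox m s₂ → InBox m s₃ →
  det s₁ s₂ ≡ 0ℤ → det s₁ s₃ ≡ 0ℤ → MinimalSolution (ZeroCombination s₁ s₂ s₃) a₁ a₂ a₃ →
  a₁ + a₂ + a₃ ≤ m * m + 4 * m
collinear-minimalSolution-bound {s₁ = x₁ , y₁} {x₂ , y₂} {x₃ , y₃}
  (x₁∈ , y₁∈) (x₂∈ , y₂∈) (x₃∈ , y₃∈) d₁₂≡0 d₁₃≡0 sol
  with x₁ ℤ.≟ 0ℤ | y₁ ℤ.≟ 0ℤ
... | no x₁≢0 | _ = minimalSolutions-bounded (∣∣≤-InRange x₁∈) (∣∣≤-InRange x₂∈) (∣∣≤-InRange x₃∈)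
  (MinimalSolution-resp sol (cong proj₁) λ {b₁} {b₂} {b₃} X≡0 →
    cong₂ _,_ X≡0
      (proportional-zero y₁ x₁≢0 (collinear-cross x₁ y₁ x₂ y₂ x₃ y₃ b₁ b₂ b₃ d₁₂≡0 d₁₃≡0) X≡0))
... | yes refl | no y₁≢0 = minimalSolutions-bounded (∣∣≤-InRange y₁∈) (∣∣≤-InRange y₂∈) (∣∣≤-InRange y₃∈)
  (MinimalSolution-resp sol (cong proj₂) λ {b₁} {b₂} {b₃} Y≡0 →
    cong₂ _,_
      (proportional-zero 0ℤ y₁≢0 (sym (collinear-cross 0ℤ y₁ x₂ y₂ x₃ y₃ b₁ b₂ b₃ d₁₂≡0 d₁₃≡0)) Y≡0)
      Y≡0)
... | yes refl | yes refl = ⊥-elim (MinimalSolution-¬unit₁ sol refl)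

∣det∣≤2m² : ∀ {m s t} → InBox m s → InBox m t → ∣ det s t ∣ ≤ 2 * (m * m)
∣det∣≤2m² {m} {x₁ , y₁} {x₂ , y₂} (x₁∈ , y₁∈) (x₂∈ , y₂∈) = begin
  ∣ x₁ ℤ.* y₂ ℤ.- x₂ ℤ.* y₁ ∣         ≤⟨ ℤ.∣i-j∣≤∣i∣+∣j∣ (x₁ ℤ.* y₂) (x₂ ℤ.* y₁) ⟩
  ∣ x₁ ℤ.* y₂ ∣ + ∣ x₂ ℤ.* y₁ ∣       ≡⟨ cong₂ _+_ (ℤ.abs-* x₁ y₂) (ℤ.abs-* x₂ y₁) ⟩
  ∣ x₁ ∣ * ∣ y₂ ∣ + ∣ x₂ ∣ * ∣ y₁ ∣   ≤⟨ +-mono-≤ (*-mono-≤ (∣∣≤-InRange x₁∈) (∣∣≤-InRange y₂∈))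
                                                  (*-mono-≤ (∣∣≤-InRange x₂∈) (∣∣≤-InRange y₁∈)) ⟩
  m * m + m * m                       ≡⟨ cong (_+_ (m * m)) (sym (+-identityʳ (m * m))) ⟩
  2 * (m * m)                         ∎
  where open ≤-Reasoning

m*m+4*m≤3*[m*m] : ∀ {m} → 2 ≤ m → m * m + 4 * m ≤ 3 * (m * m)
m*m+4*m≤3*[m*m] {m} 2≤m = begin
  m * m + 4 * m         ≡⟨ cong (_+_ (m * m)) (*-assoc 2 2 m) ⟩
  m * m + 2 * (2 * m)   ≤⟨ +-monoʳ-≤ (m * m) (*-monoʳ-≤ 2 (*-monoˡ-≤ m 2≤m)) ⟩
  m * m + 2 * (m * m)   ≡⟨⟩
  3 * (m * m)           ∎
  where open ≤-Reasoning

minors-coprime : ∀ {m} s₁ s₂ s₃ {a₁ a₂ a₃} → 2 ≤ m → InBox m s₁ → InBox m s₂ → InBox m s₃ →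
  MinimalSolution (ZeroCombination s₁ s₂ s₃) a₁ a₂ a₃ → 3 * (m * m) < a₁ + a₂ + a₃ →
  gcd₃ (∣ det s₂ s₃ ∣) (∣ det s₁ s₃ ∣) (∣ det s₁ s₂ ∣) ≡ 1
minors-coprime {m} s₁ s₂ s₃ {a₁} {a₂} {a₃} 2≤m s₁∈box s₂∈box s₃∈box sol long = g≡1 g refl
  where
  P₁ = ∣ det s₂ s₃ ∣
  P₂ = ∣ det s₁ s₃ ∣
  P₃ = ∣ det s₁ s₂ ∣
  g = gcd₃ P₁ P₂ P₃
  scaled = minimalSolution*gcd₃≡minors s₁ s₂ s₃ sol
  Σ*g≡ΣP : (a₁ + a₂ + a₃) * g ≡ P₁ + P₂ + P₃
  Σ*g≡ΣP = trans (*-distribʳ-+ g (a₁ + a₂) a₃) (cong₂ _+_ (trans (*-distribʳ-+ g a₁ a₂)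
    (cong₂ _+_ (proj₁ scaled) (proj₁ (proj₂ scaled)))) (proj₂ (proj₂ scaled)))
  ΣP≤6m² : P₁ + P₂ + P₃ ≤ 2 * (3 * (m * m))
  ΣP≤6m² = subst (P₁ + P₂ + P₃ ≤_) (6m² m)
    (+-mono-≤ (+-mono-≤ (∣det∣≤2m² s₂∈box s₃∈box) (∣det∣≤2m² s₁∈box s₃∈box)) (∣det∣≤2m² s₁∈box s₂∈box))
    where
    6m² : ∀ m → 2 * (m * m) + 2 * (m * m) + 2 * (m * m) ≡ 2 * (3 * (m * m))
    6m² = ℕ-solve-∀
  collinear : ∀ a {P} → a * 0 ≡ P → ∀ {D} → ∣ D ∣ ≡ P → D ≡ 0ℤ
  collinear a a*0≡P ∣D∣≡P = ℤ.∣i∣≡0⇒i≡0 (trans ∣D∣≡P (trans (sym a*0≡P) (*-zeroʳ a)))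
  g≡1 : ∀ k → g ≡ k → g ≡ 1
  g≡1 zero g≡0 = ⊥-elim (<⇒≱ long (≤-trans
    (collinear-minimalSolution-bound s₁∈box s₂∈box s₃∈box
      (collinear a₃ (subst (λ k → a₃ * k ≡ P₃) g≡0 (proj₂ (proj₂ scaled))) refl)
      (collinear a₂ (subst (λ k → a₂ * k ≡ P₂) g≡0 (proj₁ (proj₂ scaled))) refl) sol)
    (m*m+4*m≤3*[m*m] 2≤m)))
  g≡1 (suc zero) g≡1+0 = g≡1+0
  g≡1 (suc (suc k)) g≡2+k = ⊥-elim (<⇒≱ long (*-cancelˡ-≤ 2 (begin
    2 * (a₁ + a₂ + a₃)       ≡⟨ *-comm 2 (a₁ + a₂ + a₃) ⟩
    (a₁ + a₂ + a₃) * 2       ≤⟨ *-monoʳ-≤ (a₁ + a₂ + a₃) (subst (2 ≤_) (sym g≡2+k) (s≤s (s≤s z≤n))) ⟩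
    (a₁ + a₂ + a₃) * g       ≡⟨ Σ*g≡ΣP ⟩
    P₁ + P₂ + P₃             ≤⟨ ΣP≤6m² ⟩
    2 * (3 * (m * m))        ∎)))
    where open ≤-Reasoning

-- Multiplicities of a sequence

_≟ₚ_ : (p q : Point) → Dec (p ≡ q)
_≟ₚ_ = ≡-dec ℤ._≟_ ℤ._≟_

count : Point → Seq → ℕ
count s [] = 0
count s (x ∷ xs) with x ≟ₚ s
... | yes _ = suc (count s xs)
... | no _ = count s xs

count-here : ∀ s xs → count s (s ∷ xs) ≡ suc (count s xs)
count-here s xs with s ≟ₚ s
... | yes _ = refl
... | no s≢s = ⊥-elim (s≢s refl)

count-there : ∀ {x s} xs → x ≢ s → count s (x ∷ xs) ≡ count s xs
count-there {x} {s} xs x≢s with x ≟ₚ s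
... | yes x≡s = ⊥-elim (x≢s x≡s)
... | no _ = refl

count-++ : ∀ s xs ys → count s (xs ++ ys) ≡ count s xs + count s ys
count-++ s [] ys = refl
count-++ s (x ∷ xs) ys with x ≟ₚ s
... | yes _ = cong suc (count-++ s xs ys)
... | no _ = count-++ s xs ys

count-replicate : ∀ s n → count s (replicate n s) ≡ n
count-replicate s zero = refl
count-replicate s (suc n) = trans (count-here s _) (cong suc (count-replicate s n))

count-replicate-≢ : ∀ {t s} n → t ≢ s → count s (replicate n t) ≡ 0
count-replicate-≢ zero t≢s = refl
count-replicate-≢ (suc n) t≢s = trans (count-there _ t≢s) (count-replicate-≢ n t≢s)

count-mono : ∀ s {xs ys} → xs ⊆ ys → count s xs ≤ count s ys
count-mono s [] = z≤n
count-mono s (y ∷ʳ xs⊆ys) with y ≟ₚ s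
... | yes _ = m≤n⇒m≤1+n (count-mono s xs⊆ys)
... | no _ = count-mono s xs⊆ys
count-mono s (_∷_ {x} refl xs⊆ys) with x ≟ₚ s
... | yes _ = s≤s (count-mono s xs⊆ys)
... | no _ = count-mono s xs⊆ys

∈⇒1≤count : ∀ {s xs} → s ∈ xs → 1 ≤ count s xs
∈⇒1≤count {s} {x ∷ xs} (here refl) = subst (1 ≤_) (sym (count-here s xs)) (s≤s z≤n)
∈⇒1≤count {s} {x ∷ xs} (there s∈xs) with x ≟ₚ s
... | yes _ = s≤s z≤n
... | no _ = ∈⇒1≤count s∈xs

1≤count⇒∈ : ∀ {s} xs → 1 ≤ count s xs → s ∈ xs
1≤count⇒∈ {s} (x ∷ xs) 1≤count with x ≟ₚ s
... | yes refl = here refl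
... | no _ = there (1≤count⇒∈ xs 1≤count)

keepFirst : Point → ℕ → Seq → Seq
keepFirst s n [] = []
keepFirst s n (x ∷ xs) with x ≟ₚ s | n
... | no _ | _ = x ∷ keepFirst s n xs
... | yes _ | zero = keepFirst s zero xs
... | yes _ | suc n′ = x ∷ keepFirst s n′ xs

keepFirst-⊆ : ∀ s n xs → keepFirst s n xs ⊆ xs
keepFirst-⊆ s n [] = []
keepFirst-⊆ s n (x ∷ xs) with x ≟ₚ s | n
... | no _ | n′ = refl ∷ keepFirst-⊆ s n′ xs
... | yes _ | zero = x ∷ʳ keepFirst-⊆ s zero xs
... | yes _ | suc n′ = refl ∷ keepFirst-⊆ s n′ xs

count-keepFirst : ∀ s {n} xs → n ≤ count s xs → count s (keepFirst s n xs) ≡ n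
count-keepFirst s {n} [] z≤n = refl
count-keepFirst s {n} (x ∷ xs) n≤count with x ≟ₚ s | n
... | no x≢s | _ = trans (count-there _ x≢s) (count-keepFirst s xs n≤count)
... | yes _ | zero = count-keepFirst s xs z≤n
... | yes refl | suc n′ = trans (count-here s _) (cong suc (count-keepFirst s xs (≤-pred n≤count)))

count-keepFirst-≢ : ∀ {s t} n xs → s ≢ t → count t (keepFirst s n xs) ≡ count t xs
count-keepFirst-≢ n [] s≢t = refl
count-keepFirst-≢ {s} {t} n (x ∷ xs) s≢t with x ≟ₚ s | n
... | no _ | n′ with x ≟ₚ t
...   | yes _ = cong suc (count-keepFirst-≢ n′ xs s≢t)
...   | no _ = count-keepFirst-≢ n′ xs s≢t
count-keepFirst-≢ {s} {t} n (x ∷ xs) s≢t | yes refl | zero =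
  trans (count-keepFirst-≢ zero xs s≢t) (sym (count-there xs s≢t))
count-keepFirst-≢ {s} {t} n (x ∷ xs) s≢t | yes refl | suc n′ =
  trans (count-there _ s≢t) (trans (count-keepFirst-≢ n′ xs s≢t) (sym (count-there xs s≢t)))

≢[]⇒1≤length : ∀ {A : Set} {xs : List A} → xs ≢ [] → 1 ≤ length xs
≢[]⇒1≤length {xs = []} []≢[] = ⊥-elim ([]≢[] refl)
≢[]⇒1≤length {xs = _ ∷ _} _ = s≤s z≤n

module ThreePointSupport {s₁ s₂ s₃ : Point} (s₁≢s₂ : s₁ ≢ s₂) (s₁≢s₃ : s₁ ≢ s₃) (s₂≢s₃ : s₂ ≢ s₃) where

  Supported : Seq → Set
  Supported = All (λ x → (x ≡ s₁) ⊎ (x ≡ s₂) ⊎ (x ≡ s₃))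

  length≡Σcount : ∀ {T} → Supported T → length T ≡ count s₁ T + count s₂ T + count s₃ T
  length≡Σcount [] = refl
  length≡Σcount {_ ∷ T} (inj₁ refl ∷ supp)
    rewrite count-here s₁ T | count-there T s₁≢s₂ | count-there T s₁≢s₃ =
    cong suc (length≡Σcount supp)
  length≡Σcount {_ ∷ T} (inj₂ (inj₁ refl) ∷ supp)
    rewrite count-there T (≢-sym s₁≢s₂) | count-here s₂ T | count-there T s₂≢s₃ =
    trans (cong suc (length≡Σcount supp)) (cong (_+ count s₃ T) (sym (+-suc (count s₁ T) (count s₂ T))))
  length≡Σcount {_ ∷ T} (inj₂ (inj₂ refl) ∷ supp)
    rewrite count-there T (≢-sym s₁≢s₃) | count-there T (≢-sym s₂≢s₃) | count-here s₃ T =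
    trans (cong suc (length≡Σcount supp)) (sym (+-suc (count s₁ T + count s₂ T) (count s₃ T)))

  σ≡combination : ∀ {T} → Supported T → σ T ≡ combination s₁ s₂ s₃ (count s₁ T) (count s₂ T) (count s₃ T)
  σ≡combination [] = refl
  σ≡combination {_ ∷ T} (inj₁ refl ∷ supp)
    rewrite count-here s₁ T | count-there T s₁≢s₂ | count-there T s₁≢s₃ =
    trans (cong (s₁ ⊕_) (σ≡combination supp))
      (combination-suc₁ s₁ s₂ s₃ (count s₁ T) (count s₂ T) (count s₃ T))
  σ≡combination {_ ∷ T} (inj₂ (inj₁ refl) ∷ supp)
    rewrite count-there T (≢-sym s₁≢s₂) | count-here s₂ T | count-there T s₂≢s₃ =
    trans (cong (s₂ ⊕_) (σ≡combination supp))
      (combination-suc₂ s₁ s₂ s₃ (count s₁ T) (count s₂ T) (count s₃ T))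
  σ≡combination {_ ∷ T} (inj₂ (inj₂ refl) ∷ supp)
    rewrite count-there T (≢-sym s₁≢s₃) | count-there T (≢-sym s₂≢s₃) | count-here s₃ T =
    trans (cong (s₃ ⊕_) (σ≡combination supp))
      (combination-suc₃ s₁ s₂ s₃ (count s₁ T) (count s₂ T) (count s₃ T))

  combination-cong : ∀ {u₁ u₂ u₃ v₁ v₂ v₃} → u₁ ≡ v₁ → u₂ ≡ v₂ → u₃ ≡ v₃ →
    combination s₁ s₂ s₃ u₁ u₂ u₃ ≡ combination s₁ s₂ s₃ v₁ v₂ v₃
  combination-cong refl refl refl = refl

  sublist-with-counts : ∀ S {b₁ b₂ b₃} → b₁ ≤ count s₁ S → b₂ ≤ count s₂ S → b₃ ≤ count s₃ S →
    ∃[ T ] T ⊆ S × count s₁ T ≡ b₁ × count s₂ T ≡ b₂ × count s₃ T ≡ b₃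
  sublist-with-counts S {b₁} {b₂} {b₃} b₁≤ b₂≤ b₃≤ =
    T₃ , ⊆-trans (keepFirst-⊆ s₃ b₃ T₂) (⊆-trans (keepFirst-⊆ s₂ b₂ T₁) (keepFirst-⊆ s₁ b₁ S)) ,
    trans (count-keepFirst-≢ b₃ T₂ (≢-sym s₁≢s₃))
      (trans (count-keepFirst-≢ b₂ T₁ (≢-sym s₁≢s₂)) (count-keepFirst s₁ S b₁≤)) ,
    trans (count-keepFirst-≢ b₃ T₂ (≢-sym s₂≢s₃))
      (count-keepFirst s₂ T₁ (subst (b₂ ≤_) (sym (count-keepFirst-≢ b₁ S s₁≢s₂)) b₂≤)) ,
    count-keepFirst s₃ T₂ (subst (b₃ ≤_)
      (sym (trans (count-keepFirst-≢ b₂ T₁ s₂≢s₃) (count-keepFirst-≢ b₁ S s₁≢s₃))) b₃≤)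
    where
    T₁ = keepFirst s₁ b₁ S
    T₂ = keepFirst s₂ b₂ T₁
    T₃ = keepFirst s₃ b₃ T₂

  minimalZeroSum⇒minimalSolution : ∀ {S} → Supported S → s₁ ∈ S → s₂ ∈ S → s₃ ∈ S → MinimalZeroSum S →
    MinimalSolution (ZeroCombination s₁ s₂ s₃) (count s₁ S) (count s₂ S) (count s₃ S)
  minimalZeroSum⇒minimalSolution {S} supp s₁∈S s₂∈S s₃∈S (zeroSum , noShorter) = record
    { positive₁ = ∈⇒1≤count s₁∈S
    ; positive₂ = ∈⇒1≤count s₂∈S
    ; positive₃ = ∈⇒1≤count s₃∈S
    ; solution = trans (sym (σ≡combination supp)) zeroSum
    ; minimal = minimal }
    where
    minimal : ∀ {b₁ b₂ b₃} → b₁ ≤ count s₁ S → b₂ ≤ count s₂ S → b₃ ≤ count s₃ S → 1 ≤ b₁ + b₂ + b₃ →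
      ZeroCombination s₁ s₂ s₃ b₁ b₂ b₃ → count s₁ S + count s₂ S + count s₃ S ≤ b₁ + b₂ + b₃
    minimal b₁≤ b₂≤ b₃≤ 1≤Σb z with sublist-with-counts S b₁≤ b₂≤ b₃≤
    ... | T , T⊆S , refl , refl , refl = subst₂ _≤_ (length≡Σcount supp) (length≡Σcount suppT)
      (≮⇒≥ λ T<S → noShorter T T⊆S T≢[] T<S (trans (σ≡combination suppT) z))
      where
      suppT = All-resp-⊆ T⊆S supp
      T≢[] : T ≢ []
      T≢[] refl = <⇒≢ 1≤Σb (sym (length≡Σcount suppT))

  replicate₃ : ℕ → ℕ → ℕ → Seq
  replicate₃ p₁ p₂ p₃ = replicate p₁ s₁ ++ replicate p₂ s₂ ++ replicate p₃ s₃

  replicate₃-supported : ∀ p₁ p₂ p₃ → Supported (replicate₃ p₁ p₂ p₃)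
  replicate₃-supported p₁ p₂ p₃ = All.++⁺ (All.replicate⁺ p₁ (inj₁ refl))
    (All.++⁺ (All.replicate⁺ p₂ (inj₂ (inj₁ refl))) (All.replicate⁺ p₃ (inj₂ (inj₂ refl))))

  count-replicate₃ : ∀ p₁ p₂ p₃ →
      count s₁ (replicate₃ p₁ p₂ p₃) ≡ p₁
    × count s₂ (replicate₃ p₁ p₂ p₃) ≡ p₂
    × count s₃ (replicate₃ p₁ p₂ p₃) ≡ p₃
  count-replicate₃ p₁ p₂ p₃ =
    trans (count₃ s₁ p₁ 0 0 (count-replicate s₁ p₁) (count-replicate-≢ p₂ (≢-sym s₁≢s₂))
      (count-replicate-≢ p₃ (≢-sym s₁≢s₃))) (+-identityʳ p₁) ,
    trans (count₃ s₂ 0 p₂ 0 (count-replicate-≢ p₁ s₁≢s₂) (count-replicate s₂ p₂)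
      (count-replicate-≢ p₃ (≢-sym s₂≢s₃))) (+-identityʳ p₂) ,
    count₃ s₃ 0 0 p₃ (count-replicate-≢ p₁ s₁≢s₃) (count-replicate-≢ p₂ s₂≢s₃) (count-replicate s₃ p₃)
    where
    count₃ : ∀ s c₁ c₂ c₃ → count s (replicate p₁ s₁) ≡ c₁ → count s (replicate p₂ s₂) ≡ c₂ →
      count s (replicate p₃ s₃) ≡ c₃ → count s (replicate₃ p₁ p₂ p₃) ≡ c₁ + (c₂ + c₃)
    count₃ s c₁ c₂ c₃ e₁ e₂ e₃ = trans (count-++ s (replicate p₁ s₁) _)
      (cong₂ _+_ e₁ (trans (count-++ s (replicate p₂ s₂) _) (cong₂ _+_ e₂ e₃)))

  minimalSolution⇒admissible : ∀ {m p₁ p₂ p₃} → InBox m s₁ → InBox m s₂ → InBox m s₃ →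
    MinimalSolution (ZeroCombination s₁ s₂ s₃) p₁ p₂ p₃ →
    Admissible m (replicate₃ p₁ p₂ p₃) × length (replicate₃ p₁ p₂ p₃) ≡ p₁ + p₂ + p₃
  minimalSolution⇒admissible {m} {p₁} {p₂} {p₃} s₁∈box s₂∈box s₃∈box sol =
    ( inBox , (zeroSum , noShorter)
    , (s₁ , s₂ , s₃ , s₁≢s₂ , s₁≢s₃ , s₂≢s₃ , ∈S positive₁ c₁ , ∈S positive₂ c₂ , ∈S positive₃ c₃ , supp)) ,
    length≡
    where
    open MinimalSolution sol
    S = replicate₃ p₁ p₂ p₃
    supp = replicate₃-supported p₁ p₂ p₃
    counts = count-replicate₃ p₁ p₂ p₃
    c₁ = proj₁ counts
    c₂ = proj₁ (proj₂ counts)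
    c₃ = proj₂ (proj₂ counts)
    ∈S : ∀ {s p} → 1 ≤ p → count s S ≡ p → s ∈ S
    ∈S 1≤p c = 1≤count⇒∈ S (subst (1 ≤_) (sym c) 1≤p)
    inBox : All (InBox m) S
    inBox = All.++⁺ (All.replicate⁺ p₁ s₁∈box)
      (All.++⁺ (All.replicate⁺ p₂ s₂∈box) (All.replicate⁺ p₃ s₃∈box))
    length≡ : length S ≡ p₁ + p₂ + p₃
    length≡ = trans (length≡Σcount supp) (cong₂ _+_ (cong₂ _+_ c₁ c₂) c₃)
    zeroSum : ZeroSum S
    zeroSum = trans (σ≡combination supp) (trans (combination-cong c₁ c₂ c₃) solution)
    noShorter : ∀ T → T ⊆ S → T ≢ [] → length T < length S → ¬ ZeroSum T
    noShorter T T⊆S T≢[] T<S zeroSumT = <⇒≱ T<S (subst₂ _≤_ (sym length≡) (sym (length≡Σcount suppT))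
      (minimal (bound c₁) (bound c₂) (bound c₃) (subst (1 ≤_) (length≡Σcount suppT) (≢[]⇒1≤length T≢[]))
        (trans (sym (σ≡combination suppT)) zeroSumT)))
      where
      suppT = All-resp-⊆ T⊆S supp
      bound : ∀ {s p} → count s S ≡ p → count s T ≤ p
      bound {s} c = subst (count s T ≤_) c (count-mono s T⊆S)

-- Long admissible sequences

admissible-from-minors : ∀ {m} s₁ s₂ s₃ {p₁ p₂ p₃} → s₁ ≢ s₂ → s₁ ≢ s₃ → s₂ ≢ s₃ →
  InBox m s₁ → InBox m s₂ → InBox m s₃ →
  det s₂ s₃ ≡ + p₁ → det s₁ s₃ ≡ - + p₂ → det s₁ s₂ ≡ + p₃ →
  1 ≤ p₁ → 1 ≤ p₂ → 1 ≤ p₃ → gcd₃ p₁ p₂ p₃ ≡ 1 →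
  ∃[ T ] Admissible m T × length T ≡ p₁ + p₂ + p₃
admissible-from-minors s₁ s₂ s₃ s₁≢s₂ s₁≢s₃ s₂≢s₃ s₁∈box s₂∈box s₃∈box e₁ e₂ e₃ 1≤p₁ 1≤p₂ 1≤p₃ coprime =
  _ , minimalSolution⇒admissible s₁∈box s₂∈box s₃∈box
        (minimalSolution-from-minors s₁ s₂ s₃ e₁ e₂ e₃ 1≤p₁ 1≤p₂ 1≤p₃ coprime)
  where open ThreePointSupport s₁≢s₂ s₁≢s₃ s₂≢s₃

InRange-+ : ∀ {m k} → k ≤ m → InRange m (+ k)
InRange-+ k≤m = ℤ.neg-≤-pos , ℤ.+≤+ k≤m

InRange-[1+] : ∀ {m k} → k ≤ m → InRange (suc m) -[1+ k ]
InRange-[1+] k≤m = ℤ.-≤- k≤m , ℤ.-≤+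

long-enough : ∀ {m n} → 3 * (m * m) < n → ∃[ T ] Admissible m T × length T ≡ n →
  ∃[ T ] Admissible m T × 3 * (m * m) < length T
long-enough 3m²<n (T , admissible , length≡n) = T , admissible , subst (_ <_) (sym length≡n) 3m²<n

-- For m = 3 the points (−3,−3), (3,−2), (−1,3) have minors 7, −12, 15; for m ≥ 4 the points
-- (m, m−1), (−(m−1), −(m−2)), (m, −m) have minors m(2m−3), −m(2m−1), 1, summing to 4m(m−1) + 1.
long-admissible : ∀ m → 3 ≤ m → ∃[ T ] Admissible m T × 3 * (m * m) < length T
long-admissible 0 ()
long-admissible 1 (s≤s ())
long-admissible 2 (s≤s (s≤s ()))
long-admissible 3 _ = long-enough (m≤m+n 28 6)
  (admissible-from-minors (-[1+ 2 ] , -[1+ 2 ]) (+ 3 , -[1+ 1 ]) (-[1+ 0 ] , + 3)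
    (λ ()) (λ ()) (λ ())
    (InRange-[1+] ≤-refl , InRange-[1+] ≤-refl) (InRange-+ ≤-refl , InRange-[1+] (s≤s z≤n))
    (InRange-[1+] z≤n , InRange-+ ≤-refl)
    refl refl refl (s≤s z≤n) (s≤s z≤n) (s≤s z≤n) refl)
long-admissible (suc (suc (suc (suc n)))) _ = long-enough long
  (admissible-from-minors
    (+ (4 + n) , + (3 + n)) (-[1+ 2 + n ] , -[1+ 1 + n ]) (+ (4 + n) , -[1+ 3 + n ])
    (λ ()) (λ ()) (λ ())
    (InRange-+ ≤-refl , InRange-+ (n≤1+n _))
    (InRange-[1+] (n≤1+n _) , InRange-[1+] (m≤n⇒m≤1+n (n≤1+n _)))
    (InRange-+ ≤-refl , InRange-[1+] ≤-refl)
    D₁≡ D₂≡ D₃≡ (s≤s z≤n) (s≤s z≤n) (s≤s z≤n) coprime)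
  where
  p₁ p₂ : ℕ
  p₁ = (4 + n) * (5 + (n + n))
  p₂ = (4 + n) * (7 + (n + n))
  minor₁ : ∀ N → (- (+ 3 ℤ.+ N)) ℤ.* (- (+ 4 ℤ.+ N)) ℤ.- (+ 4 ℤ.+ N) ℤ.* (- (+ 2 ℤ.+ N))
                   ≡ (+ 4 ℤ.+ N) ℤ.* (+ 5 ℤ.+ (N ℤ.+ N))
  minor₁ = ℤ-solve-∀
  minor₂ : ∀ N → (+ 4 ℤ.+ N) ℤ.* (- (+ 4 ℤ.+ N)) ℤ.- (+ 4 ℤ.+ N) ℤ.* (+ 3 ℤ.+ N)
                   ≡ - ((+ 4 ℤ.+ N) ℤ.* (+ 7 ℤ.+ (N ℤ.+ N)))
  minor₂ = ℤ-solve-∀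
  minor₃ : ∀ N → (+ 4 ℤ.+ N) ℤ.* (- (+ 2 ℤ.+ N)) ℤ.- (- (+ 3 ℤ.+ N)) ℤ.* (+ 3 ℤ.+ N) ≡ + 1
  minor₃ = ℤ-solve-∀
  D₁≡ = trans (minor₁ (+ n)) (sym (ℤ.pos-* (4 + n) (5 + (n + n))))
  D₂≡ = trans (minor₂ (+ n)) (cong -_ (sym (ℤ.pos-* (4 + n) (7 + (n + n)))))
  D₃≡ = minor₃ (+ n)
  coprime : gcd₃ p₁ p₂ 1 ≡ 1
  coprime = trans (cong (gcd p₁) (gcd-zeroʳ p₂)) (gcd-zeroʳ p₁)
  Σ≡ : ∀ n → (4 + n) * (5 + (n + n)) + (4 + n) * (7 + (n + n)) + 1
           ≡ 1 + (3 * ((4 + n) * (4 + n)) + (4 + n) * n)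
  Σ≡ = ℕ-solve-∀
  long : 3 * ((4 + n) * (4 + n)) < p₁ + p₂ + 1
  long = subst (3 * ((4 + n) * (4 + n)) <_) (sym (Σ≡ n))
    (s≤s (m≤m+n (3 * ((4 + n) * (4 + n))) ((4 + n) * n)))

columns-InRange : ∀ {m s₁ s₂ s₃} → InBox m s₁ → InBox m s₂ → InBox m s₃ →
  ∀ r c → InRange m (columns s₁ s₂ s₃ r c)
columns-InRange (x₁∈ , _) _ _ zero zero = x₁∈
columns-InRange (_ , y₁∈) _ _ (suc zero) zero = y₁∈
columns-InRange _ (x₂∈ , _) _ zero (suc zero) = x₂∈
columns-InRange _ (_ , y₂∈) _ (suc zero) (suc zero) = y₂∈
columns-InRange _ _ (x₃∈ , _) zero (suc (suc zero)) = x₃∈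
columns-InRange _ _ (_ , y₃∈) (suc zero) (suc (suc zero)) = y₃∈

minimalSolution≡minors : ∀ s₁ s₂ s₃ {a₁ a₂ a₃} → MinimalSolution (ZeroCombination s₁ s₂ s₃) a₁ a₂ a₃ →
  gcd₃ (∣ det s₂ s₃ ∣) (∣ det s₁ s₃ ∣) (∣ det s₁ s₂ ∣) ≡ 1 →
  a₁ ≡ ∣ det s₂ s₃ ∣ × a₂ ≡ ∣ det s₁ s₃ ∣ × a₃ ≡ ∣ det s₁ s₂ ∣
minimalSolution≡minors s₁ s₂ s₃ {a₁} {a₂} {a₃} sol g≡1 =
  unscale a₁ (proj₁ scaled) , unscale a₂ (proj₁ (proj₂ scaled)) , unscale a₃ (proj₂ (proj₂ scaled))
  where
  scaled = minimalSolution*gcd₃≡minors s₁ s₂ s₃ sol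
  unscale : ∀ a {P} → a * gcd₃ (∣ det s₂ s₃ ∣) (∣ det s₁ s₃ ∣) (∣ det s₁ s₂ ∣) ≡ P → a ≡ P
  unscale a eq = trans (sym (*-identityʳ a)) (trans (cong (a *_) (sym g≡1)) eq)

-- detA (columns s₁ s₂ s₃) i reduces to det of the two other points, and Δ (columns s₁ s₂ s₃) to
-- + gcd₃ of the absolute values of these three determinants.
columns-minors≢0 : ∀ {s₁ s₂ s₃} → 1 ≤ ∣ det s₂ s₃ ∣ → 1 ≤ ∣ det s₁ s₃ ∣ → 1 ≤ ∣ det s₁ s₂ ∣ →
  ∀ i → detA (columns s₁ s₂ s₃) i ≢ 0ℤ
columns-minors≢0 1≤P₁ _ _ zero D≡0 = <⇒≢ 1≤P₁ (sym (cong ∣_∣ D≡0))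
columns-minors≢0 _ 1≤P₂ _ (suc zero) D≡0 = <⇒≢ 1≤P₂ (sym (cong ∣_∣ D≡0))
columns-minors≢0 _ _ 1≤P₃ (suc (suc zero)) D≡0 = <⇒≢ 1≤P₃ (sym (cong ∣_∣ D≡0))

lemma19 : (m : ℕ) → m ≥ 3 → (S : Seq) → (s₁ s₂ s₃ : Point) →
    SupportIs S s₁ s₂ s₃ → AttainsD3 m S →
    InC m (columns s₁ s₂ s₃) ×
    (length S ≡ ∣ detA (columns s₁ s₂ s₃) zero ∣ + ∣ detA (columns s₁ s₂ s₃) (suc zero) ∣ + ∣ detA (columns s₁ s₂ s₃) (suc (suc zero)) ∣)
lemma19 m 3≤m S s₁ s₂ s₃ (s₁≢s₂ , s₁≢s₃ , s₂≢s₃ , s₁∈S , s₂∈S , s₃∈S , supported)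
  ((inBox , minimalS , _) , maximal) =
    ( columns-InRange box₁ box₂ box₃
    , columns-minors≢0
        (subst (1 ≤_) a₁≡P₁ positive₁) (subst (1 ≤_) a₂≡P₂ positive₂) (subst (1 ≤_) a₃≡P₃ positive₃)
    , cong +_ coprime )
  , trans (length≡Σcount supported) (cong₂ _+_ (cong₂ _+_ a₁≡P₁ a₂≡P₂) a₃≡P₃)
  where
  open ThreePointSupport s₁≢s₂ s₁≢s₃ s₂≢s₃
  box₁ = All.lookup inBox s₁∈S
  box₂ = All.lookup inBox s₂∈S
  box₃ = All.lookup inBox s₃∈S
  sol = minimalZeroSum⇒minimalSolution supported s₁∈S s₂∈S s₃∈S minimalS
  open MinimalSolution sol using (positive₁; positive₂; positive₃)
  long : 3 * (m * m) < count s₁ S + count s₂ S + count s₃ S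
  long = let (T , admissible , T-long) = long-admissible m 3≤m in
    <-≤-trans T-long (subst (length T ≤_) (length≡Σcount supported) (maximal T admissible))
  coprime = minors-coprime s₁ s₂ s₃ (≤-trans (n≤1+n 2) 3≤m) box₁ box₂ box₃ sol long
  a≡P = minimalSolution≡minors s₁ s₂ s₃ sol coprime
  a₁≡P₁ = proj₁ a≡P
  a₂≡P₂ = proj₁ (proj₂ a≡P)
  a₃≡P₃ = proj₂ (proj₂ a≡P)
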